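{- Let $s\ge 2$, $k\ge 1$, $0\le t\le k$ and $\lambda\ge 1$ be integers, and let $\{a_c\}_{c\ge 0}$ be defined by $a_0=\lambda$ and $a_c=\lambda-\sum_{e=0}^{c-1}a_e\binom{k-t}{c-e}(s-1)^{c-e}$ for $c\ge 1$. Write $[s]=\{1,\dots,s\}$, $\mathbf 1=(1,\dots,1)\in[s]^k$, and for $\mathbf u,\mathbf v\in[s]^k$ let $d(\mathbf u,\mathbf v)$ be the number of coordinates in which they differ. For $\mathbf x\in[s]^k$ let $I_{\mathbf x}=\{i: x_i\ne 1\}$ and $J_{\mathbf x}=\{\mathbf y\in[s]^k: y_i=x_i\ \forall i\in I_{\mathbf x}\}$. Consider the system, in real variables $N_{\mathbf y}$ indexed by $\mathbf y\in[s]^k$ with $d(\mathbf 1,\mathbf y)>t$, consisting of \[ a_{t-d(\mathbf 1,\mathbf x)}+(-1)^{t-d(\mathbf 1,\mathbf x)+1}\sum_{\mathbf y\in J_{\mathbf x},\ d(\mathbf 1,\mathbf y)>t}\binom{d(\mathbf 1,\mathbf y)-d(\mathbf 1,\mathbf x)-1}{t-d(\mathbf 1,\mathbf x)}N_{\mathbf y}\ \ge 0\quad\text{for every }\mathbf x\in[s]^k\text{ with }0\le d(\mathbf 1,\mathbf x)\le t, \] together with $N_{\mathbf y}\ge 0$ for every $\mathbf y$ with $d(\mathbf 1,\mathbf y)>t$. Then an $\mathrm{OA}(\lambda s^t,k,s,t)$ exists if and only if this system has a solution in which all $N_{\mathbf y}$ are integers.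
   Context: An orthogonal array $\mathrm{OA}(N,k,s,t)$ of strength $t$ is an $N\times k$ array (factorial design with $N$ runs and $k$ factors) with entries in $\{1,\dots,s\}$ such that, for any choice of $t$ columns, each of the $s^t$ possible $t$-tuples of levels appears exactly $\lambda=N/s^t$ times as a row of the projection onto those columns. -}

module Defs where

open import Data.Nat using (ℕ; zero; suc; _∸_; _<_; _<?_; _≟_)
  renaming (_*_ to _*ℕ_; _^_ to _^ℕ_; _+_ to _+ℕ_)
open import Data.Nat.Combinatorics using (_C_)
open import Data.Integer using (ℤ; +_; _+_; _-_; _*_; _≤_; -1ℤ; 0ℤ; _^_)
open import Data.Fin using (Fin; toℕ; fromℕ)
open import Data.Fin.Properties using () renaming (_≟_ to _≟F_)
open import Data.Vec using (Vec; []; _∷_; _∷ʳ_; lookup; tabulate; count)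
open import Data.Vec.Properties using (≡-dec)
open import Data.Vec.Relation.Binary.Pointwise.Inductive using (Pointwise)
import Data.Vec.Relation.Binary.Pointwise.Inductive as PW
open import Data.List using (List; []; _∷_; map; concatMap; filter; foldr; allFin)
open import Data.Sum using (_⊎_)
open import Data.Product using (_×_; Σ)
open import Relation.Nullary using (¬?; Dec; _⊎-dec_; _×-dec_)
open import Relation.Binary.PropositionalEquality using (_≡_; _≢_)
open import Function.Definitions using (Injective)

-- Points of [s]^k; the level "1" of [s] is the element of Fin s with toℕ = 0.
Point : ℕ → ℕ → Set
Point s k = Vec (Fin s) k

d1 : ∀ {s k} → Point s k → ℕ
d1 = count (λ a → ¬? (toℕ a ≟ 0))

-- y ∈ J_x : for every i with x_i ≠ 1, y_i = x_i
-- (pointwise: x_i = 1 or y_i = x_i)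
InJ : ∀ {s k} → Point s k → Point s k → Set
InJ x y = Pointwise (λ xi yi → toℕ xi ≡ 0 ⊎ yi ≡ xi) x y

InJ? : ∀ {s k} (x y : Point s k) → Dec (InJ x y)
InJ? x y = PW.decidable (λ xi yi → (toℕ xi ≟ 0) ⊎-dec (yi ≟F xi)) x y

allPoints : (s k : ℕ) → List (Point s k)
allPoints s zero = [] ∷ []
allPoints s (suc k) = concatMap (λ i → map (i ∷_) (allPoints s k)) (allFin s)

sumℤ : List ℤ → ℤ
sumℤ = foldr _+_ 0ℤ

-- aVec lam s k t c = (a_0, ..., a_{c-1})
aVec : (lam s k t : ℕ) → (c : ℕ) → Vec ℤ c
aVec lam s k t zero = []
aVec lam s k t (suc c) =
  v ∷ʳ ((+ lam) - sumℤ (map (λ e → lookup v e * (+ (((k ∸ t) C (c ∸ toℕ e)) *ℕ ((s ∸ 1) ^ℕ (c ∸ toℕ e))))) (allFin c)))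
  where
  v : Vec ℤ c
  v = aVec lam s k t c

aSeq : (lam s k t : ℕ) → ℕ → ℤ
aSeq lam s k t c = lookup (aVec lam s k t (suc c)) (fromℕ c)

IsOAStrength : ∀ {N} (lam s k t : ℕ) → Vec (Point s k) N → Set
IsOAStrength lam s k t A =
  (c : Fin t → Fin k) → Injective _≡_ _≡_ c → (u : Vec (Fin s) t) →
  count (λ r → ≡-dec _≟F_ (tabulate (λ j → lookup r (c j))) u) A ≡ lam

OAExists : (lam s k t : ℕ) → Set
OAExists lam s k t = Σ (Vec (Point s k) (lam *ℕ (s ^ℕ t))) (IsOAStrength lam s k t)

constraintLHS : (lam s k t : ℕ) → (Point s k → ℤ) → Point s k → ℤ
constraintLHS lam s k t N x =
  aSeq lam s k t (t ∸ d1 x) +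
  (-1ℤ ^ (t ∸ d1 x +ℕ 1)) *
    sumℤ (map (λ y → (+ ((d1 y ∸ d1 x ∸ 1) C (t ∸ d1 x))) * N y)
              (filter (λ y → InJ? x y ×-dec (t <? d1 y)) (allPoints s k)))

-- the system has a solution with all N_y integers (N values at points with
-- d(1,y) ≤ t are not variables and do not occur)
SystemHasIntegerSolution : (lam s k t : ℕ) → Set
SystemHasIntegerSolution lam s k t =
  Σ (Point s k → ℤ) λ N →
    ((x : Point s k) → d1 x Data.Nat.≤ t → 0ℤ ≤ constraintLHS lam s k t N x) ×
    ((y : Point s k) → t < d1 y → 0ℤ ≤ N y)

module Submission where

-- Let s = 1 + s', let w(x) = d(1, x) be the weight of x ∈ [s]^k; x is light if w(x) ≤ t and
-- heavy otherwise.  An OA(λ s^t, k, s, t) is a multiplicity function on [s]^k summing to λ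
-- over every t-subcube (points with t prescribed coordinates, given by a `Pattern`).
-- Integer values N on the heavy points extend to the `completion`, whose value at a light x
-- is the left-hand side of the constraint of x.  After generic finite sums come two binomial
-- identities: the convolution satisfied by a_c (`aConvolution`) and an alternating one
-- (`heavyCancellation`).  Counting the points x of a subcube with y ∈ J_x (`jSum-profile`)
-- they give the central fact `subcubeSum-completion`: the completion sums to λ over every
-- t-subcube.  Conversely, a function vanishing on heavy points with zero t-subcube sums is
-- zero (`rigidity`), as every light point is isolated in a t-subcube of heavier points.
-- So a nonnegative solution gives the array with multiplicities `completion`
-- (`oaFromSolution`), and the multiplicities of an array are the completion of their heavy
-- values, whence the constraints hold (`solutionFromOA`).

open import Defs
open import Data.Nat using (ℕ; _≤_)
open import Function.Bundles using (_⇔_; mk⇔)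

open import Data.Nat using (zero; suc; _∸_; _<_; _≤?_; _<?_; z≤n; s≤s)
  renaming (_+_ to _+ℕ_; _*_ to _*ℕ_; _^_ to _^ℕ_)
import Data.Nat as ℕ
import Data.Nat.Properties as NP
open import Data.Nat.Combinatorics using (_C_; k>n⇒nCk≡0; nCk+nC[k+1]≡[n+1]C[k+1])
open import Data.Integer using (ℤ; +_; _+_; _-_; -_; _*_; -1ℤ; 0ℤ; 1ℤ; _^_)
import Data.Integer as ℤ
import Data.Integer.Properties as ZP
open import Data.Integer.Tactic.RingSolver using (solve-∀)
open import Data.Fin using (Fin; toℕ; fromℕ; inject₁; punchIn; punchOut)
  renaming (zero to fz; suc to fs)
import Data.Fin.Properties as FP
open import Data.Vec using (Vec; []; _∷_; _∷ʳ_; lookup; tabulate; count; replicate)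
import Data.Vec as V
import Data.Vec.Properties as VP
import Data.Vec.Relation.Binary.Pointwise.Inductive as PW
open import Data.List using (List; map; concatMap; filter; allFin)
import Data.List as L
import Data.List.Properties as LP
open import Data.Sum using (_⊎_; inj₁; inj₂)
open import Data.Product using (_×_; Σ; _,_; proj₁; proj₂)
open import Data.Unit using (⊤; tt)
open import Data.Empty using (⊥-elim)
open import Relation.Nullary using (Dec; yes; no; ¬_; _×-dec_; _⊎-dec_)
open import Relation.Binary.PropositionalEquality
open import Function.Definitions using (Injective)
open import Function using (_∘_; id)

open ≡-Reasoning

𝟙 : ∀ {a} {P : Set a} → Dec P → ℤ
𝟙 (yes _) = 1ℤ
𝟙 (no _) = 0ℤ

𝟙-⇔ : ∀ {a b} {P : Set a} {Q : Set b} → (P → Q) → (Q → P) →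
      (p : Dec P) (q : Dec Q) → 𝟙 p ≡ 𝟙 q
𝟙-⇔ f g (yes p) (yes q) = refl
𝟙-⇔ f g (yes p) (no ¬q) = ⊥-elim (¬q (f p))
𝟙-⇔ f g (no ¬p) (yes q) = ⊥-elim (¬p (g q))
𝟙-⇔ f g (no ¬p) (no ¬q) = refl

𝟙-× : ∀ {a b} {P : Set a} {Q : Set b} (p : Dec P) (q : Dec Q) →
      𝟙 (p ×-dec q) ≡ 𝟙 p * 𝟙 q
𝟙-× (yes p) (yes q) = refl
𝟙-× (yes p) (no q) = refl
𝟙-× (no p) (yes q) = refl
𝟙-× (no p) (no q) = refl

𝟙-×-* : ∀ {a b} {P : Set a} {Q : Set b} (p : Dec P) (q : Dec Q) (x : ℤ) →
        𝟙 (p ×-dec q) * x ≡ 𝟙 p * (𝟙 q * x)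
𝟙-×-* p q x = trans (cong (_* x) (𝟙-× p q)) (ZP.*-assoc (𝟙 p) (𝟙 q) x)

𝟙-true : ∀ {a} {P : Set a} → P → (p : Dec P) (x : ℤ) → 𝟙 p * x ≡ x
𝟙-true _ (yes _) x = ZP.*-identityˡ x
𝟙-true h (no ¬h) x = ⊥-elim (¬h h)

𝟙-false : ∀ {a} {P : Set a} → ¬ P → (p : Dec P) (x : ℤ) → 𝟙 p * x ≡ 0ℤ
𝟙-false ¬h (yes h) x = ⊥-elim (¬h h)
𝟙-false _ (no _) x = ZP.*-zeroˡ x

module _ {a} {A : Set a} where
  ΣL : List A → (A → ℤ) → ℤ
  ΣL xs F = sumℤ (map F xs)

  ΣL-cong : ∀ xs {F G : A → ℤ} → (∀ x → F x ≡ G x) → ΣL xs F ≡ ΣL xs G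
  ΣL-cong L.[] e = refl
  ΣL-cong (x L.∷ xs) e = cong₂ _+_ (e x) (ΣL-cong xs e)

  ΣL-zero : ∀ xs {F : A → ℤ} → (∀ x → F x ≡ 0ℤ) → ΣL xs F ≡ 0ℤ
  ΣL-zero L.[] e = refl
  ΣL-zero (x L.∷ xs) e = cong₂ _+_ (e x) (ΣL-zero xs e)

  ΣL-+ : ∀ xs (F G : A → ℤ) → ΣL xs (λ x → F x + G x) ≡ ΣL xs F + ΣL xs G
  ΣL-+ L.[] F G = refl
  ΣL-+ (x L.∷ xs) F G = trans (cong (_+_ (F x + G x)) (ΣL-+ xs F G))
                              (interchange (F x) (G x) (ΣL xs F) (ΣL xs G))
    where
    interchange : ∀ a b c d → a + b + (c + d) ≡ a + c + (b + d)
    interchange = solve-∀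

  ΣL-* : ∀ xs c (F : A → ℤ) → ΣL xs (λ x → c * F x) ≡ c * ΣL xs F
  ΣL-* L.[] c F = sym (ZP.*-zeroʳ c)
  ΣL-* (x L.∷ xs) c F = trans (cong (_+_ (c * F x)) (ΣL-* xs c F))
                              (sym (ZP.*-distribˡ-+ c (F x) (ΣL xs F)))

  ΣL-filter : ∀ {p} {P : A → Set p} (P? : ∀ x → Dec (P x)) xs (F : A → ℤ) →
    ΣL (filter P? xs) F ≡ ΣL xs (λ x → 𝟙 (P? x) * F x)
  ΣL-filter P? L.[] F = refl
  ΣL-filter P? (x L.∷ xs) F with P? x
  ... | yes _ = cong₂ _+_ (sym (ZP.*-identityˡ (F x))) (ΣL-filter P? xs F)
  ... | no _ = trans (ΣL-filter P? xs F) (sym (ZP.+-identityˡ _))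

  ΣL-++ : ∀ xs ys (F : A → ℤ) → ΣL (xs L.++ ys) F ≡ ΣL xs F + ΣL ys F
  ΣL-++ L.[] ys F = sym (ZP.+-identityˡ _)
  ΣL-++ (x L.∷ xs) ys F =
    trans (cong (_+_ (F x)) (ΣL-++ xs ys F)) (sym (ZP.+-assoc (F x) _ _))

module _ {a b} {A : Set a} {B : Set b} where
  ΣL-swap : ∀ (xs : List A) (ys : List B) (F : A → B → ℤ) →
    ΣL xs (λ x → ΣL ys (F x)) ≡ ΣL ys (λ y → ΣL xs (λ x → F x y))
  ΣL-swap L.[] ys F = sym (ΣL-zero ys (λ _ → refl))
  ΣL-swap (x L.∷ xs) ys F = trans (cong (_+_ (ΣL ys (F x))) (ΣL-swap xs ys F))
    (sym (ΣL-+ ys (F x) (λ y → ΣL xs (λ x → F x y))))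

  ΣL-map : ∀ (f : A → B) xs (F : B → ℤ) → ΣL (map f xs) F ≡ ΣL xs (F ∘ f)
  ΣL-map f xs F = cong sumℤ (sym (LP.map-∘ xs))

  ΣL-concatMap : ∀ (g : A → List B) xs (F : B → ℤ) →
    ΣL (concatMap g xs) F ≡ ΣL xs (λ x → ΣL (g x) F)
  ΣL-concatMap g L.[] F = refl
  ΣL-concatMap g (x L.∷ xs) F =
    trans (ΣL-++ (g x) (concatMap g xs) F) (cong (_+_ (ΣL (g x) F)) (ΣL-concatMap g xs F))

ΣF : ∀ n → (Fin n → ℤ) → ℤ
ΣF n G = ΣL (allFin n) G

ΣF-suc : ∀ n G → ΣF (suc n) G ≡ G fz + ΣF n (G ∘ fs)
ΣF-suc n G = cong (λ xs → G fz + sumℤ xs)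
  (trans (LP.map-tabulate fs G) (sym (LP.map-tabulate id (G ∘ fs))))

ΣF-const : ∀ n c → ΣF n (λ _ → c) ≡ + n * c
ΣF-const zero c = sym (ZP.*-zeroˡ c)
ΣF-const (suc n) c = begin
  ΣF (suc n) (λ _ → c)  ≡⟨ ΣF-suc n (λ _ → c) ⟩
  c + ΣF n (λ _ → c)    ≡⟨ cong (_+_ (c)) (ΣF-const n c) ⟩
  c + + n * c           ≡⟨ oneMore c (+ n) ⟩
  + suc n * c           ∎
  where
  oneMore : ∀ c m → c + m * c ≡ (1ℤ + m) * c
  oneMore = solve-∀

ΣF-δ : ∀ n (j : Fin n) (G : Fin n → ℤ) → ΣF n (λ i → 𝟙 (i FP.≟ j) * G i) ≡ G j
ΣF-δ (suc n) fz G = begin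
  ΣF (suc n) (λ i → 𝟙 (i FP.≟ fz) * G i)      ≡⟨ ΣF-suc n (λ i → 𝟙 (i FP.≟ fz) * G i) ⟩
  1ℤ * G fz + ΣF n (λ i → 0ℤ * G (fs i))       ≡⟨ cong₂ _+_ (ZP.*-identityˡ (G fz))
                                                   (ΣL-zero (allFin n) (ZP.*-zeroˡ ∘ G ∘ fs)) ⟩
  G fz + 0ℤ                                    ≡⟨ ZP.+-identityʳ (G fz) ⟩
  G fz                                         ∎
ΣF-δ (suc n) (fs j) G = begin
  ΣF (suc n) (λ i → 𝟙 (i FP.≟ fs j) * G i)                ≡⟨ ΣF-suc n (λ i → 𝟙 (i FP.≟ fs j) * G i) ⟩
  0ℤ * G fz + ΣF n (λ i → 𝟙 (fs i FP.≟ fs j) * G (fs i))   ≡⟨ cong₂ _+_ (ZP.*-zeroˡ (G fz))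
                                                               (ΣL-cong (allFin n) shift) ⟩
  0ℤ + ΣF n (λ i → 𝟙 (i FP.≟ j) * G (fs i))               ≡⟨ ZP.+-identityˡ _ ⟩
  ΣF n (λ i → 𝟙 (i FP.≟ j) * G (fs i))                    ≡⟨ ΣF-δ n j (G ∘ fs) ⟩
  G (fs j)                                                 ∎
  where
  shift : ∀ i → 𝟙 (fs i FP.≟ fs j) * G (fs i) ≡ 𝟙 (i FP.≟ j) * G (fs i)
  shift i = cong (_* G (fs i)) (𝟙-⇔ FP.suc-injective (cong fs) (fs i FP.≟ fs j) (i FP.≟ j))

Σ< : ℕ → (ℕ → ℤ) → ℤ
Σ< zero F = 0ℤ
Σ< (suc n) F = Σ< n F + F n

Σ<-cong : ∀ n {F G : ℕ → ℤ} → (∀ j → j < n → F j ≡ G j) → Σ< n F ≡ Σ< n G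
Σ<-cong zero e = refl
Σ<-cong (suc n) e = cong₂ _+_ (Σ<-cong n (λ j p → e j (NP.m≤n⇒m≤1+n p))) (e n NP.≤-refl)

Σ<-head : ∀ n F → Σ< (suc n) F ≡ F 0 + Σ< n (F ∘ suc)
Σ<-head zero F = trans (ZP.+-identityˡ (F 0)) (sym (ZP.+-identityʳ (F 0)))
Σ<-head (suc n) F = trans (cong (_+ F (suc n)) (Σ<-head n F)) (ZP.+-assoc (F 0) _ _)

Σ<-+ : ∀ n F G → Σ< n (λ j → F j + G j) ≡ Σ< n F + Σ< n G
Σ<-+ zero F G = refl
Σ<-+ (suc n) F G = trans (cong (_+ (F n + G n)) (Σ<-+ n F G))
                         (interchange (Σ< n F) (Σ< n G) (F n) (G n))
  where
  interchange : ∀ a b c d → a + b + (c + d) ≡ a + c + (b + d)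
  interchange = solve-∀

Σ<-* : ∀ n c F → Σ< n (λ j → c * F j) ≡ c * Σ< n F
Σ<-* zero c F = sym (ZP.*-zeroʳ c)
Σ<-* (suc n) c F = trans (cong (_+ c * F n) (Σ<-* n c F))
                         (sym (ZP.*-distribˡ-+ c (Σ< n F) (F n)))

Σ<-pad : ∀ n m F → (∀ j → n ≤ j → F j ≡ 0ℤ) → Σ< (n +ℕ m) F ≡ Σ< n F
Σ<-pad n zero F z = cong (λ l → Σ< l F) (NP.+-identityʳ n)
Σ<-pad n (suc m) F z = begin
  Σ< (n +ℕ suc m) F             ≡⟨ cong (λ l → Σ< l F) (NP.+-suc n m) ⟩
  Σ< (n +ℕ m) F + F (n +ℕ m)    ≡⟨ cong (_+_ (Σ< (n +ℕ m) F)) (z (n +ℕ m) (NP.m≤m+n n m)) ⟩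
  Σ< (n +ℕ m) F + 0ℤ            ≡⟨ ZP.+-identityʳ _ ⟩
  Σ< (n +ℕ m) F                 ≡⟨ Σ<-pad n m F z ⟩
  Σ< n F                        ∎

Σ<-reverse : ∀ n H → Σ< (suc n) (λ j → H (n ∸ j)) ≡ Σ< (suc n) H
Σ<-reverse zero H = refl
Σ<-reverse (suc n) H = begin
  Σ< (suc (suc n)) (λ j → H (suc n ∸ j))   ≡⟨ Σ<-head (suc n) (λ j → H (suc n ∸ j)) ⟩
  H (suc n) + Σ< (suc n) (λ j → H (n ∸ j)) ≡⟨ cong (_+_ (H (suc n))) (Σ<-reverse n H) ⟩
  H (suc n) + Σ< (suc n) H                 ≡⟨ ZP.+-comm (H (suc n)) _ ⟩
  Σ< (suc (suc n)) H                       ∎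

ΣF-toℕ : ∀ n g → ΣF n (g ∘ toℕ) ≡ Σ< n g
ΣF-toℕ zero g = refl
ΣF-toℕ (suc n) g = begin
  ΣF (suc n) (g ∘ toℕ)            ≡⟨ ΣF-suc n (g ∘ toℕ) ⟩
  g 0 + ΣF n (g ∘ suc ∘ toℕ)      ≡⟨ cong (_+_ (g 0)) (ΣF-toℕ n (g ∘ suc)) ⟩
  g 0 + Σ< n (g ∘ suc)            ≡⟨ sym (Σ<-head n g) ⟩
  Σ< (suc n) g                    ∎

pos-^ : ∀ x n → + (x ^ℕ n) ≡ (+ x) ^ n
pos-^ x zero = refl
pos-^ x (suc n) = trans (ZP.pos-* x (x ^ℕ n)) (cong (+ x *_) (pos-^ x n))

-- binSum m c φ = Σ_j C(c, j) m^j φ(j), defined through Pascal's rule so that it unfolds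
-- along a free coordinate of a subcube (see `weightSum`).
binSum : ℤ → ℕ → (ℕ → ℤ) → ℤ
binSum m zero φ = φ 0
binSum m (suc c) φ = binSum m c φ + m * binSum m c (φ ∘ suc)

binSum-cong : ∀ m c {φ ψ : ℕ → ℤ} → (∀ j → φ j ≡ ψ j) → binSum m c φ ≡ binSum m c ψ
binSum-cong m zero e = e 0
binSum-cong m (suc c) e =
  cong₂ _+_ (binSum-cong m c e) (cong (m *_) (binSum-cong m c (e ∘ suc)))

binSum-neg : ∀ m c φ → binSum m c (λ j → - φ j) ≡ - binSum m c φ
binSum-neg m zero φ = refl
binSum-neg m (suc c) φ =
  trans (cong₂ (λ u v → u + m * v) (binSum-neg m c φ) (binSum-neg m c (φ ∘ suc)))
        (negate (binSum m c φ) (binSum m c (φ ∘ suc)) m)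
  where
  negate : ∀ a b m → - a + m * - b ≡ - (a + m * b)
  negate = solve-∀

binSum-zero : ∀ m c {φ} → (∀ j → φ j ≡ 0ℤ) → binSum m c φ ≡ 0ℤ
binSum-zero m zero z = z 0
binSum-zero m (suc c) z = begin
  binSum m c _ + m * binSum m c _  ≡⟨ cong₂ (λ u v → u + m * v) (binSum-zero m c z)
                                                               (binSum-zero m c (z ∘ suc)) ⟩
  0ℤ + m * 0ℤ                      ≡⟨ trans (ZP.+-identityˡ (m * 0ℤ)) (ZP.*-zeroʳ m) ⟩
  0ℤ                               ∎

binSum-explicit : ∀ m c φ → binSum m c φ ≡ Σ< (suc c) (λ j → + (c C j) * (m ^ j) * φ j)
binSum-explicit m zero φ = lonely (φ 0)
  where
  lonely : ∀ x → x ≡ 0ℤ + 1ℤ * 1ℤ * x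
  lonely = solve-∀
binSum-explicit m (suc c) φ = begin
  binSum m c φ + m * binSum m c (φ ∘ suc)
    ≡⟨ cong₂ (λ u v → u + m * v) (binSum-explicit m c φ) (binSum-explicit m c (φ ∘ suc)) ⟩
  Σ< (suc c) F + m * Σ< (suc c) F′
    ≡⟨ cong (_+ m * Σ< (suc c) F′) (Σ<-head c F) ⟩
  F 0 + Σ< c (F ∘ suc) + m * Σ< (suc c) F′
    ≡⟨ regroup (F 0) (Σ< c (F ∘ suc)) (m * Σ< (suc c) F′) ⟩
  F 0 + (Σ< c (F ∘ suc) + 0ℤ + m * Σ< (suc c) F′)
    ≡⟨ cong (λ z → F 0 + (Σ< c (F ∘ suc) + z + m * Σ< (suc c) F′)) (sym lastVanishes) ⟩
  F 0 + (Σ< (suc c) (F ∘ suc) + m * Σ< (suc c) F′)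
    ≡⟨ cong (λ z → F 0 + (Σ< (suc c) (F ∘ suc) + z)) (sym (Σ<-* (suc c) m F′)) ⟩
  F 0 + (Σ< (suc c) (F ∘ suc) + Σ< (suc c) (λ j → m * F′ j))
    ≡⟨ cong (_+_ (F 0)) (sym (Σ<-+ (suc c) (F ∘ suc) (λ j → m * F′ j))) ⟩
  F 0 + Σ< (suc c) (λ j → F (suc j) + m * F′ j)
    ≡⟨ cong (_+_ (F 0)) (Σ<-cong (suc c) (λ j _ → sym (pascal j))) ⟩
  H 0 + Σ< (suc c) (H ∘ suc)
    ≡⟨ sym (Σ<-head (suc c) H) ⟩
  Σ< (suc (suc c)) H ∎
  where
  F F′ H : ℕ → ℤ
  F j = + (c C j) * (m ^ j) * φ j
  F′ j = + (c C j) * (m ^ j) * φ (suc j)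
  H j = + (suc c C j) * (m ^ j) * φ j
  lastVanishes : F (suc c) ≡ 0ℤ
  lastVanishes rewrite k>n⇒nCk≡0 {c} {suc c} NP.≤-refl = ZP.*-zeroˡ (φ (suc c))
  regroup : ∀ a b c → a + b + c ≡ a + (b + 0ℤ + c)
  regroup = solve-∀
  pascal : ∀ j → H (suc j) ≡ F (suc j) + m * F′ j
  pascal j rewrite sym (nCk+nC[k+1]≡[n+1]C[k+1] c j) | ZP.pos-+ (c C j) (c C suc j) =
    split (+ (c C j)) (+ (c C suc j)) m (m ^ j) (φ (suc j))
    where
    split : ∀ x y m p f → (x + y) * (m * p) * f ≡ y * (m * p) * f + m * (x * p * f)
    split = solve-∀

-- γ b n is the n-th coefficient of the power series (1 - x)^(b - 1):
-- γ 0 n = 1 (the series 1/(1 - x)) and γ (1 + b) n = (-1)^n C(b, n).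
γ : ℕ → ℕ → ℤ
γ zero n = 1ℤ
γ (suc b) n = -1ℤ ^ n * + (b C n)

γ-0 : ∀ b → γ b 0 ≡ 1ℤ
γ-0 zero = refl
γ-0 (suc b) = refl

-- (1 - x)^b = (1 - x)^(b-1) - x (1 - x)^(b-1), read coefficientwise.
γ-pascal : ∀ b n → γ (suc b) (suc n) + γ b n ≡ γ b (suc n)
γ-pascal zero n rewrite k>n⇒nCk≡0 {0} {suc n} (s≤s z≤n) =
  cong (_+ 1ℤ) (ZP.*-zeroʳ (-1ℤ ^ suc n))
γ-pascal (suc b) n
  rewrite sym (nCk+nC[k+1]≡[n+1]C[k+1] b n) | ZP.pos-+ (b C n) (b C suc n) =
  pascal (-1ℤ ^ n) (+ (b C n)) (+ (b C suc n))
  where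
  pascal : ∀ p x y → (-1ℤ * p) * (x + y) + p * x ≡ (-1ℤ * p) * y
  pascal = solve-∀

altTerm : ℕ → ℕ → ℕ → ℤ
altTerm M n j = 𝟙 (j ≤? n) * (-1ℤ ^ (n ∸ j) * + ((M ∸ j) C (n ∸ j)))

-- Σ_j C(c, j) (-1)^(n-j) C(b + c - 1 - j, n - j) = γ b n  whenever n < b + c;
-- by induction on c, each step being Pascal's rule for C(c, j) and for γ.
alternatingConvolution : ∀ c b n M → M +ℕ 1 ≡ b +ℕ c → n < b +ℕ c →
  binSum 1ℤ c (altTerm M n) ≡ γ b n
alternatingConvolution zero b n M M+1≡b _
  with trans (NP.+-comm 1 M) (trans M+1≡b (NP.+-identityʳ b))
... | refl = 𝟙-true z≤n (0 ≤? n) (-1ℤ ^ n * + (M C n))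
alternatingConvolution (suc c) b zero M e _ = begin
  binSum 1ℤ c (altTerm M 0) + 1ℤ * binSum 1ℤ c (altTerm M 0 ∘ suc)
    ≡⟨ cong₂ (λ u v → u + 1ℤ * v)
             (alternatingConvolution c (suc b) 0 M (trans e (NP.+-suc b c)) (s≤s z≤n))
             (binSum-zero 1ℤ c (λ j → 𝟙-false (λ ()) (suc j ≤? 0) (altTerm′ j))) ⟩
  γ (suc b) 0 + 1ℤ * 0ℤ
    ≡⟨ ZP.+-identityʳ _ ⟩
  γ (suc b) 0
    ≡⟨ trans (γ-0 (suc b)) (sym (γ-0 b)) ⟩
  γ b 0 ∎
  where
  altTerm′ : ℕ → ℤ
  altTerm′ j = -1ℤ ^ (0 ∸ suc j) * + ((M ∸ suc j) C (0 ∸ suc j))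
alternatingConvolution (suc c) b (suc n) zero e n<b+c with subst (suc n <_) (sym e) n<b+c
... | s≤s ()
alternatingConvolution (suc c) b (suc n) (suc M) e n<b+c = begin
  binSum 1ℤ c (altTerm (suc M) (suc n)) + 1ℤ * binSum 1ℤ c (altTerm (suc M) (suc n) ∘ suc)
    ≡⟨ cong₂ (λ u v → u + 1ℤ * v)
             (alternatingConvolution c (suc b) (suc n) (suc M) e′ (subst (suc n <_) b+c+1 n<b+c))
             (binSum-cong 1ℤ c shift) ⟩
  γ (suc b) (suc n) + 1ℤ * binSum 1ℤ c (altTerm M n)
    ≡⟨ cong (λ v → γ (suc b) (suc n) + v)
            (trans (ZP.*-identityˡ _) (alternatingConvolution c b n M e″ n<b+c′)) ⟩
  γ (suc b) (suc n) + γ b n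
    ≡⟨ γ-pascal b n ⟩
  γ b (suc n) ∎
  where
  b+c+1 : b +ℕ suc c ≡ suc b +ℕ c
  b+c+1 = NP.+-suc b c
  e′ : suc M +ℕ 1 ≡ suc b +ℕ c
  e′ = trans e b+c+1
  e″ : M +ℕ 1 ≡ b +ℕ c
  e″ = NP.suc-injective e′
  n<b+c′ : n < b +ℕ c
  n<b+c′ = NP.≤-pred (subst (suc n <_) b+c+1 n<b+c)
  shift : ∀ j → altTerm (suc M) (suc n) (suc j) ≡ altTerm M n j
  shift j = cong (_* (-1ℤ ^ (n ∸ j) * + ((M ∸ j) C (n ∸ j))))
                 (𝟙-⇔ NP.≤-pred s≤s (suc j ≤? suc n) (j ≤? n))

-- κ t D w is the coefficient of N_y, for y of weight D, in the constraint of a light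
-- point x of weight w: (-1)^(t-w+1) C(D - w - 1, t - w), and 0 unless w ≤ t.
κ : ℕ → ℕ → ℕ → ℤ
κ t D w = 𝟙 (w ≤? t) * ((-1ℤ ^ (t ∸ w +ℕ 1)) * (+ ((D ∸ w ∸ 1) C (t ∸ w))))

shiftedTop : ∀ a b c j → a +ℕ b +ℕ c ∸ (a +ℕ j) ∸ 1 ≡ b +ℕ c ∸ 1 ∸ j
shiftedTop a b c j rewrite NP.+-assoc a b c | NP.[m+n]∸[m+o]≡n∸o a (b +ℕ c) j
                         | NP.∸-+-assoc (b +ℕ c) j 1 | NP.∸-+-assoc (b +ℕ c) 1 j | NP.+-comm j 1 = refl

κ-altTerm : ∀ a b c t D j → a ≤ t → D ≡ a +ℕ b +ℕ c →
  κ t D (a +ℕ j) ≡ - altTerm (b +ℕ c ∸ 1) (t ∸ a) j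
κ-altTerm a b c t D j a≤t refl with (a +ℕ j) ≤? t | j ≤? t ∸ a
... | yes _ | yes _ rewrite sym (NP.∸-+-assoc t a j) | NP.+-comm (t ∸ a ∸ j) 1
                          | shiftedTop a b c j =
  signFlip (-1ℤ ^ (t ∸ a ∸ j)) (+ ((b +ℕ c ∸ 1 ∸ j) C (t ∸ a ∸ j)))
  where
  signFlip : ∀ p x → 1ℤ * (-1ℤ * p * x) ≡ - (1ℤ * (p * x))
  signFlip = solve-∀
... | no _ | no _ = trans (ZP.*-zeroˡ (-1ℤ ^ (t ∸ (a +ℕ j) +ℕ 1) * + ((D ∸ (a +ℕ j) ∸ 1) C (t ∸ (a +ℕ j)))))
                          (sym (cong -_ (ZP.*-zeroˡ (-1ℤ ^ (t ∸ a ∸ j) * + ((b +ℕ c ∸ 1 ∸ j) C (t ∸ a ∸ j))))))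
... | yes a+j≤t | no j≰t-a =
  ⊥-elim (j≰t-a (subst (_≤ t ∸ a) (NP.m+n∸m≡n a j) (NP.∸-monoˡ-≤ a a+j≤t)))
... | no a+j≰t | yes j≤t-a =
  ⊥-elim (a+j≰t (subst (a +ℕ j ≤_) (NP.m+[n∸m]≡n a≤t) (NP.+-monoʳ-≤ a j≤t-a)))

δ₀ : ℕ → ℤ
δ₀ zero = 1ℤ
δ₀ (suc _) = 0ℤ

δ₀-γ : ∀ b n → b ≤ n → δ₀ b ≡ γ b n
δ₀-γ zero n _ = refl
δ₀-γ (suc b) n b≤n rewrite k>n⇒nCk≡0 {b} {n} b≤n = sym (ZP.*-zeroʳ (-1ℤ ^ n))

heavyCancellation : ∀ a b c t D → D ≡ a +ℕ b +ℕ c → a +ℕ b ≤ t → t < D →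
  δ₀ b + binSum 1ℤ c (κ t D ∘ (a +ℕ_)) ≡ 0ℤ
heavyCancellation a b c t D D≡ a+b≤t t<D = begin
  δ₀ b + binSum 1ℤ c (κ t D ∘ (a +ℕ_))
    ≡⟨ cong₂ _+_ (δ₀-γ b (t ∸ a) b≤t-a) (binSum-cong 1ℤ c (λ j → κ-altTerm a b c t D j a≤t D≡)) ⟩
  γ b (t ∸ a) + binSum 1ℤ c (λ j → - altTerm (b +ℕ c ∸ 1) (t ∸ a) j)
    ≡⟨ cong (_+_ (γ b (t ∸ a))) (binSum-neg 1ℤ c (altTerm (b +ℕ c ∸ 1) (t ∸ a))) ⟩
  γ b (t ∸ a) - binSum 1ℤ c (altTerm (b +ℕ c ∸ 1) (t ∸ a))
    ≡⟨ cong (λ z → γ b (t ∸ a) - z) (alternatingConvolution c b (t ∸ a) (b +ℕ c ∸ 1) M+1 t-a<b+c) ⟩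
  γ b (t ∸ a) - γ b (t ∸ a)
    ≡⟨ ZP.+-inverseʳ (γ b (t ∸ a)) ⟩
  0ℤ ∎
  where
  a≤t : a ≤ t
  a≤t = NP.m+n≤o⇒m≤o a a+b≤t
  b≤t-a : b ≤ t ∸ a
  b≤t-a = subst (_≤ t ∸ a) (NP.m+n∸m≡n a b) (NP.∸-monoˡ-≤ a a+b≤t)
  t-a<b+c : t ∸ a < b +ℕ c
  t-a<b+c = NP.+-cancelˡ-< a (t ∸ a) (b +ℕ c)
    (subst₂ _<_ (sym (NP.m+[n∸m]≡n a≤t)) (trans D≡ (NP.+-assoc a b c)) t<D)
  M+1 : b +ℕ c ∸ 1 +ℕ 1 ≡ b +ℕ c
  M+1 = NP.m∸n+n≡m (NP.≤-trans (s≤s z≤n) t-a<b+c)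

module Sequence (lam s k t : ℕ) where
  a : ℕ → ℤ
  a = aSeq lam s k t

  coef : ℕ → ℤ
  coef d = + (((k ∸ t) C d) *ℕ ((s ∸ 1) ^ℕ d))

  private
    lastIndex : ∀ {ℓ} {A : Set ℓ} {n} (v : Vec A n) x → lookup (v ∷ʳ x) (fromℕ n) ≡ x
    lastIndex [] x = refl
    lastIndex (y ∷ v) x = lastIndex v x

    earlierIndex : ∀ {ℓ} {A : Set ℓ} {n} (v : Vec A n) x (e : Fin n) →
      lookup (v ∷ʳ x) (inject₁ e) ≡ lookup v e
    earlierIndex (y ∷ v) x fz = refl
    earlierIndex (y ∷ v) x (fs e) = earlierIndex v x e

    lastOrEarlier : ∀ {n} (e : Fin (suc n)) → e ≡ fromℕ n ⊎ Σ (Fin n) (λ e′ → e ≡ inject₁ e′)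
    lastOrEarlier {zero} fz = inj₁ refl
    lastOrEarlier {suc n} fz = inj₂ (fz , refl)
    lastOrEarlier {suc n} (fs e) with lastOrEarlier e
    ... | inj₁ eq = inj₁ (cong fs eq)
    ... | inj₂ (e′ , eq) = inj₂ (fs e′ , cong fs eq)

  lookup-aVec : ∀ c (e : Fin c) → lookup (aVec lam s k t c) e ≡ a (toℕ e)
  lookup-aVec (suc c) e with lastOrEarlier e
  ... | inj₁ refl = cong a (sym (FP.toℕ-fromℕ c))
  ... | inj₂ (e′ , refl) = begin
    lookup (aVec lam s k t c ∷ʳ _) (inject₁ e′)  ≡⟨ earlierIndex (aVec lam s k t c) _ e′ ⟩
    lookup (aVec lam s k t c) e′                 ≡⟨ lookup-aVec c e′ ⟩
    a (toℕ e′)                                   ≡⟨ cong a (sym (FP.toℕ-inject₁ e′)) ⟩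
    a (toℕ (inject₁ e′))                         ∎

  recursion : ∀ c → a c + Σ< c (λ e → a e * coef (c ∸ e)) ≡ + lam
  recursion c = begin
    a c + S                     ≡⟨ cong (_+ S) (lastIndex (aVec lam s k t c) _) ⟩
    (+ lam - S′) + S            ≡⟨ cong (λ z → (+ lam - z) + S) S′≡S ⟩
    (+ lam - S) + S             ≡⟨ cancel (+ lam) S ⟩
    + lam                       ∎
    where
    S S′ : ℤ
    S = Σ< c (λ e → a e * coef (c ∸ e))
    S′ = ΣF c (λ e → lookup (aVec lam s k t c) e * coef (c ∸ toℕ e))
    S′≡S : S′ ≡ S
    S′≡S = trans (ΣL-cong (allFin c) (λ e → cong (_* coef (c ∸ toℕ e)) (lookup-aVec c e)))
                 (ΣF-toℕ c (λ e → a e * coef (c ∸ e)))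
    cancel : ∀ x y → x - y + y ≡ x
    cancel = solve-∀

  -- Equivalently, Σ_j C(k - t, j) (s - 1)^j a_{c-j} = λ for every c: reindex the binomial
  -- sum by e = c - j after truncating it to j ≤ min(k - t, c).
  aConvolution : ∀ c → binSum (+ (s ∸ 1)) (k ∸ t) (λ j → 𝟙 (j ≤? c) * a (c ∸ j)) ≡ + lam
  aConvolution c = begin
    binSum m K φ                     ≡⟨ binSum-explicit m K φ ⟩
    Σ< (suc K) T                     ≡⟨ sym (Σ<-pad (suc K) (suc c) T beyondK) ⟩
    Σ< (suc K +ℕ suc c) T            ≡⟨ cong (λ n → Σ< n T) (NP.+-comm (suc K) (suc c)) ⟩
    Σ< (suc c +ℕ suc K) T            ≡⟨ Σ<-pad (suc c) (suc K) T beyondc ⟩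
    Σ< (suc c) T                     ≡⟨ Σ<-cong (suc c) reindex ⟩
    Σ< (suc c) (λ j → H (c ∸ j))     ≡⟨ Σ<-reverse c H ⟩
    Σ< c H + H c                     ≡⟨ cong (_+_ (Σ< c H)) lastTerm ⟩
    Σ< c H + a c                     ≡⟨ ZP.+-comm (Σ< c H) (a c) ⟩
    a c + Σ< c H                     ≡⟨ recursion c ⟩
    + lam                            ∎
    where
    K : ℕ
    K = k ∸ t
    m : ℤ
    m = + (s ∸ 1)
    φ T H : ℕ → ℤ
    φ j = 𝟙 (j ≤? c) * a (c ∸ j)
    T j = + (K C j) * (m ^ j) * φ j
    H e = a e * coef (c ∸ e)
    beyondK : ∀ j → suc K ≤ j → T j ≡ 0ℤ
    beyondK j K<j rewrite k>n⇒nCk≡0 {K} {j} K<j = ZP.*-zeroˡ (φ j)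
    beyondc : ∀ j → suc c ≤ j → T j ≡ 0ℤ
    beyondc j c<j = trans (cong (+ (K C j) * (m ^ j) *_) (𝟙-false (NP.<⇒≱ c<j) (j ≤? c) _))
                          (ZP.*-zeroʳ (+ (K C j) * (m ^ j)))
    lastTerm : H c ≡ a c
    lastTerm = trans (cong (λ z → a c * coef z) (NP.n∸n≡0 c)) (ZP.*-identityʳ (a c))
    reindex : ∀ j → j < suc c → T j ≡ H (c ∸ j)
    reindex j (s≤s j≤c) = begin
      + (K C j) * (m ^ j) * (𝟙 (j ≤? c) * a (c ∸ j))  ≡⟨ cong (+ (K C j) * (m ^ j) *_)
                                                          (𝟙-true j≤c (j ≤? c) (a (c ∸ j))) ⟩
      + (K C j) * (m ^ j) * a (c ∸ j)                ≡⟨ ZP.*-comm _ (a (c ∸ j)) ⟩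
      a (c ∸ j) * (+ (K C j) * m ^ j)                ≡⟨ cong (a (c ∸ j) *_) (sym coefEq) ⟩
      a (c ∸ j) * coef (c ∸ (c ∸ j))                 ∎
      where
      coefEq : coef (c ∸ (c ∸ j)) ≡ + (K C j) * m ^ j
      coefEq = trans (cong coef (NP.m∸[m∸n]≡n j≤c))
                 (trans (ZP.pos-* (K C j) ((s ∸ 1) ^ℕ j)) (cong (+ (K C j) *_) (pos-^ (s ∸ 1) j)))

-- A pattern q : Pattern s k r prescribes the levels of r of the k coordinates; the points
-- matching it form a subcube of [s]^k.
data Pattern (s : ℕ) : ℕ → ℕ → Set where
  end  : Pattern s 0 0
  fix  : ∀ {k r} → Fin s → Pattern s k r → Pattern s (suc k) (suc r)
  free : ∀ {k r} → Pattern s k r → Pattern s (suc k) r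

Match : ∀ {s k r} → Pattern s k r → Point s k → Set
Match end [] = ⊤
Match (fix v q) (x ∷ xs) = x ≡ v × Match q xs
Match (free q) (x ∷ xs) = Match q xs

match? : ∀ {s k r} (q : Pattern s k r) (x : Point s k) → Dec (Match q x)
match? end [] = yes tt
match? (fix v q) (x ∷ xs) = (x FP.≟ v) ×-dec match? q xs
match? (free q) (x ∷ xs) = match? q xs

freeCount : ∀ {s k r} → Pattern s k r → ℕ
freeCount end = 0
freeCount (fix v q) = freeCount q
freeCount (free q) = suc (freeCount q)

freeCount-∸ : ∀ {s k r} (q : Pattern s k r) → freeCount q ≡ k ∸ r
freeCount-∸ {r = r} q = trans (sym (NP.m+n∸n≡m (freeCount q) r)) (cong (_∸ r) (counts q))
  where
  counts : ∀ {s k r} (q : Pattern s k r) → freeCount q +ℕ r ≡ k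
  counts end = refl
  counts (fix v q) = trans (NP.+-suc (freeCount q) _) (cong suc (counts q))
  counts (free q) = cong suc (counts q)

w₁ : ∀ {s} → Fin s → ℕ
w₁ fz = 0
w₁ (fs _) = 1

d1-∷ : ∀ {s k} (x : Fin s) (xs : Point s k) → d1 (x ∷ xs) ≡ w₁ x +ℕ d1 xs
d1-∷ fz xs = refl
d1-∷ (fs x) xs = refl

fixedWeight : ∀ {s k r} → Pattern s k r → ℕ
fixedWeight end = 0
fixedWeight (fix v q) = w₁ v +ℕ fixedWeight q
fixedWeight (free q) = fixedWeight q

fixedWeight≤ : ∀ {s k r} (q : Pattern s k r) → fixedWeight q ≤ r
fixedWeight≤ end = z≤n
fixedWeight≤ (fix fz q) = NP.m≤n⇒m≤1+n (fixedWeight≤ q)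
fixedWeight≤ (fix (fs v) q) = s≤s (fixedWeight≤ q)
fixedWeight≤ (free q) = fixedWeight≤ q

_≟P_ : ∀ {s k} → (x y : Point s k) → Dec (x ≡ y)
_≟P_ = VP.≡-dec FP._≟_

module PointSums (s : ℕ) where
  ΣP : ∀ k → (Point s k → ℤ) → ℤ
  ΣP k F = ΣL (allPoints s k) F

  ΣP-cong : ∀ k {F G : Point s k → ℤ} → (∀ x → F x ≡ G x) → ΣP k F ≡ ΣP k G
  ΣP-cong k = ΣL-cong (allPoints s k)

  ΣP-zero : ∀ k {F : Point s k → ℤ} → (∀ x → F x ≡ 0ℤ) → ΣP k F ≡ 0ℤ
  ΣP-zero k = ΣL-zero (allPoints s k)

  ΣP-* : ∀ k c F → ΣP k (λ x → c * F x) ≡ c * ΣP k F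
  ΣP-* k = ΣL-* (allPoints s k)

  ΣP-+ : ∀ k F G → ΣP k (λ x → F x + G x) ≡ ΣP k F + ΣP k G
  ΣP-+ k = ΣL-+ (allPoints s k)

  ΣP-suc : ∀ k F → ΣP (suc k) F ≡ ΣF s (λ i → ΣP k (λ xs → F (i ∷ xs)))
  ΣP-suc k F = trans (ΣL-concatMap (λ i → map (i ∷_) (allPoints s k)) (allFin s) F)
                     (ΣL-cong (allFin s) (λ i → ΣL-map (i ∷_) (allPoints s k) F))

  ΣP-δ : ∀ k (r : Point s k) (G : Point s k → ℤ) → ΣP k (λ x → 𝟙 (x ≟P r) * G x) ≡ G r
  ΣP-δ zero [] G = trans (ZP.+-identityʳ (1ℤ * G [])) (ZP.*-identityˡ (G []))
  ΣP-δ (suc k) (r ∷ rs) G = begin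
    ΣP (suc k) (λ x → 𝟙 (x ≟P (r ∷ rs)) * G x)
      ≡⟨ ΣP-suc k (λ x → 𝟙 (x ≟P (r ∷ rs)) * G x) ⟩
    ΣF s (λ i → ΣP k (λ xs → 𝟙 ((i ∷ xs) ≟P (r ∷ rs)) * G (i ∷ xs)))
      ≡⟨ ΣL-cong (allFin s) (λ i → trans (ΣP-cong k (factor i))
                                         (ΣP-* k (𝟙 (i FP.≟ r)) (λ xs → 𝟙 (xs ≟P rs) * G (i ∷ xs)))) ⟩
    ΣF s (λ i → 𝟙 (i FP.≟ r) * ΣP k (λ xs → 𝟙 (xs ≟P rs) * G (i ∷ xs)))
      ≡⟨ ΣL-cong (allFin s) (λ i → cong (𝟙 (i FP.≟ r) *_) (ΣP-δ k rs (λ xs → G (i ∷ xs)))) ⟩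
    ΣF s (λ i → 𝟙 (i FP.≟ r) * G (i ∷ rs))
      ≡⟨ ΣF-δ s r (λ i → G (i ∷ rs)) ⟩
    G (r ∷ rs) ∎
    where
    factor : ∀ i xs → 𝟙 ((i ∷ xs) ≟P (r ∷ rs)) * G (i ∷ xs)
                    ≡ 𝟙 (i FP.≟ r) * (𝟙 (xs ≟P rs) * G (i ∷ xs))
    factor i xs = trans (cong (_* G (i ∷ xs))
                          (𝟙-⇔ VP.∷-injective (λ (e₁ , e₂) → cong₂ _∷_ e₁ e₂)
                               ((i ∷ xs) ≟P (r ∷ rs)) ((i FP.≟ r) ×-dec (xs ≟P rs))))
                        (𝟙-×-* (i FP.≟ r) (xs ≟P rs) (G (i ∷ xs)))

  ΣQ : ∀ {k r} → Pattern s k r → (Point s k → ℤ) → ℤ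
  ΣQ {k} q F = ΣP k (λ x → 𝟙 (match? q x) * F x)

  ΣQ-cong : ∀ {k r} (q : Pattern s k r) {F G : Point s k → ℤ} → (∀ x → F x ≡ G x) →
    ΣQ q F ≡ ΣQ q G
  ΣQ-cong {k} q e = ΣP-cong k (λ x → cong (𝟙 (match? q x) *_) (e x))

  ΣQ-+ : ∀ {k r} (q : Pattern s k r) F G → ΣQ q (λ x → F x + G x) ≡ ΣQ q F + ΣQ q G
  ΣQ-+ {k} q F G = trans (ΣP-cong k (λ x → ZP.*-distribˡ-+ (𝟙 (match? q x)) (F x) (G x)))
                         (ΣP-+ k (λ x → 𝟙 (match? q x) * F x) (λ x → 𝟙 (match? q x) * G x))

  ΣQ-end : ∀ (F : Point s 0 → ℤ) → ΣQ end F ≡ F []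
  ΣQ-end F = trans (ZP.+-identityʳ (1ℤ * F [])) (ZP.*-identityˡ (F []))

  ΣQ-fix : ∀ {k r} v (q : Pattern s k r) (F : Point s (suc k) → ℤ) →
    ΣQ (fix v q) F ≡ ΣQ q (λ xs → F (v ∷ xs))
  ΣQ-fix {k} v q F = begin
    ΣQ (fix v q) F
      ≡⟨ ΣP-suc k (λ x → 𝟙 (match? (fix v q) x) * F x) ⟩
    ΣF s (λ i → ΣP k (λ xs → 𝟙 ((i FP.≟ v) ×-dec match? q xs) * F (i ∷ xs)))
      ≡⟨ ΣL-cong (allFin s) (λ i → trans (ΣP-cong k (λ xs → 𝟙-×-* (i FP.≟ v) (match? q xs) (F (i ∷ xs))))
                                         (ΣP-* k (𝟙 (i FP.≟ v)) (λ xs → 𝟙 (match? q xs) * F (i ∷ xs)))) ⟩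
    ΣF s (λ i → 𝟙 (i FP.≟ v) * ΣQ q (λ xs → F (i ∷ xs)))
      ≡⟨ ΣF-δ s v (λ i → ΣQ q (λ xs → F (i ∷ xs))) ⟩
    ΣQ q (λ xs → F (v ∷ xs)) ∎

  ΣQ-free : ∀ {k r} (q : Pattern s k r) (F : Point s (suc k) → ℤ) →
    ΣQ (free q) F ≡ ΣF s (λ i → ΣQ q (λ xs → F (i ∷ xs)))
  ΣQ-free {k} q F = ΣP-suc k (λ x → 𝟙 (match? (free q) x) * F x)

-- From here on s = 1 + s', so that the level 1 exists.
module Subcubes (s' : ℕ) where
  open PointSums (suc s')

  -- A function of the weight, summed over a subcube: every free coordinate contributes
  -- weight 0 once and weight 1 in s' ways.
  weightSum : ∀ {k r} (q : Pattern (suc s') k r) (ψ : ℕ → ℤ) →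
    ΣQ q (ψ ∘ d1) ≡ binSum (+ s') (freeCount q) (λ j → ψ (fixedWeight q +ℕ j))
  weightSum end ψ = ΣQ-end (ψ ∘ d1)
  weightSum (fix v q) ψ = begin
    ΣQ (fix v q) (ψ ∘ d1)
      ≡⟨ ΣQ-fix v q (ψ ∘ d1) ⟩
    ΣQ q (λ xs → ψ (d1 (v ∷ xs)))
      ≡⟨ ΣQ-cong q (λ xs → cong ψ (d1-∷ v xs)) ⟩
    ΣQ q (λ xs → ψ (w₁ v +ℕ d1 xs))
      ≡⟨ weightSum q (λ w → ψ (w₁ v +ℕ w)) ⟩
    binSum (+ s') (freeCount q) (λ j → ψ (w₁ v +ℕ (fixedWeight q +ℕ j)))
      ≡⟨ binSum-cong (+ s') (freeCount q) (λ j → cong ψ (sym (NP.+-assoc (w₁ v) (fixedWeight q) j))) ⟩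
    binSum (+ s') (freeCount q) (λ j → ψ (w₁ v +ℕ fixedWeight q +ℕ j)) ∎
  weightSum (free q) ψ = begin
    ΣQ (free q) (ψ ∘ d1)
      ≡⟨ ΣQ-free q (ψ ∘ d1) ⟩
    ΣF (suc s') (λ i → ΣQ q (λ xs → ψ (d1 (i ∷ xs))))
      ≡⟨ ΣF-suc s' (λ i → ΣQ q (λ xs → ψ (d1 (i ∷ xs)))) ⟩
    ΣQ q (ψ ∘ d1) + ΣF s' (λ _ → ΣQ q (ψ ∘ suc ∘ d1))
      ≡⟨ cong (_+_ (ΣQ q (ψ ∘ d1))) (ΣF-const s' (ΣQ q (ψ ∘ suc ∘ d1))) ⟩
    ΣQ q (ψ ∘ d1) + + s' * ΣQ q (ψ ∘ suc ∘ d1)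
      ≡⟨ cong₂ (λ u v → u + + s' * v) (weightSum q ψ) (weightSum q (ψ ∘ suc)) ⟩
    binSum (+ s') (freeCount q) (λ j → ψ (fixedWeight q +ℕ j))
      + + s' * binSum (+ s') (freeCount q) (λ j → ψ (suc (fixedWeight q +ℕ j)))
      ≡⟨ cong (λ z → binSum (+ s') (freeCount q) (λ j → ψ (fixedWeight q +ℕ j)) + + s' * z)
              (binSum-cong (+ s') (freeCount q) (λ j → cong ψ (sym (NP.+-suc (fixedWeight q) j)))) ⟩
    binSum (+ s') (suc (freeCount q)) (λ j → ψ (fixedWeight q +ℕ j)) ∎

  jLevel? : (x y : Fin (suc s')) → Dec (toℕ x ≡ 0 ⊎ y ≡ x)
  jLevel? x y = (toℕ x ℕ.≟ 0) ⊎-dec (y FP.≟ x)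

  𝟙-InJ-∷ : ∀ {k} x y (xs ys : Point (suc s') k) →
    𝟙 (InJ? (x ∷ xs) (y ∷ ys)) ≡ 𝟙 (jLevel? x y) * 𝟙 (InJ? xs ys)
  𝟙-InJ-∷ x y xs ys =
    trans (𝟙-⇔ (λ { (p PW.∷ ps) → p , ps }) (λ (p , ps) → p PW.∷ ps)
            (InJ? (x ∷ xs) (y ∷ ys)) (jLevel? x y ×-dec InJ? xs ys))
          (𝟙-× (jLevel? x y) (InJ? xs ys))

  off1 : Fin (suc s') → ℤ
  off1 fz = 0ℤ
  off1 (fs _) = 1ℤ

  -- jSum q y ψ computes Σ_{x in the subcube of q, y ∈ J_x} ψ(w(x)) coordinatewise: on a
  -- fixed coordinate x_i is forced; on a free one x_i = 1, or x_i = y_i when y_i ≠ 1.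
  jSum : ∀ {k r} → Pattern (suc s') k r → Point (suc s') k → (ℕ → ℤ) → ℤ
  jSum end [] ψ = ψ 0
  jSum (fix v q) (y ∷ ys) ψ = 𝟙 (jLevel? v y) * jSum q ys (ψ ∘ (w₁ v +ℕ_))
  jSum (free q) (y ∷ ys) ψ = jSum q ys ψ + off1 y * jSum q ys (ψ ∘ suc)

  restrictLevel : ∀ {k r} v (q : Pattern (suc s') k r) (ys : Point (suc s') k) y (ψ : ℕ → ℤ) →
    ΣQ q (λ xs → 𝟙 (InJ? (v ∷ xs) (y ∷ ys)) * ψ (d1 (v ∷ xs)))
      ≡ 𝟙 (jLevel? v y) * ΣQ q (λ xs → 𝟙 (InJ? xs ys) * ψ (w₁ v +ℕ d1 xs))
  restrictLevel {k} v q ys y ψ =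
    trans (ΣP-cong k factor) (ΣP-* k (𝟙 (jLevel? v y)) (λ xs → 𝟙 (match? q xs) * (𝟙 (InJ? xs ys) * ψ (w₁ v +ℕ d1 xs))))
    where
    factor : ∀ xs → 𝟙 (match? q xs) * (𝟙 (InJ? (v ∷ xs) (y ∷ ys)) * ψ (d1 (v ∷ xs)))
                  ≡ 𝟙 (jLevel? v y) * (𝟙 (match? q xs) * (𝟙 (InJ? xs ys) * ψ (w₁ v +ℕ d1 xs)))
    factor xs rewrite 𝟙-InJ-∷ v y xs ys | d1-∷ v xs =
      swap (𝟙 (match? q xs)) (𝟙 (jLevel? v y)) (𝟙 (InJ? xs ys)) (ψ (w₁ v +ℕ d1 xs))
      where
      swap : ∀ m l j p → m * (l * j * p) ≡ l * (m * (j * p))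
      swap = solve-∀

  jSum-correct : ∀ {k r} (q : Pattern (suc s') k r) (y : Point (suc s') k) (ψ : ℕ → ℤ) →
    ΣQ q (λ x → 𝟙 (InJ? x y) * ψ (d1 x)) ≡ jSum q y ψ
  jSum-correct end [] ψ = trans (ΣQ-end (λ x → 𝟙 (InJ? x []) * ψ (d1 x))) (ZP.*-identityˡ (ψ 0))
  jSum-correct {suc k} (fix v q) (y ∷ ys) ψ = begin
    ΣQ (fix v q) (λ x → 𝟙 (InJ? x (y ∷ ys)) * ψ (d1 x))
      ≡⟨ ΣQ-fix v q (λ x → 𝟙 (InJ? x (y ∷ ys)) * ψ (d1 x)) ⟩
    ΣQ q (λ xs → 𝟙 (InJ? (v ∷ xs) (y ∷ ys)) * ψ (d1 (v ∷ xs)))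
      ≡⟨ restrictLevel v q ys y ψ ⟩
    𝟙 (jLevel? v y) * ΣQ q (λ xs → 𝟙 (InJ? xs ys) * ψ (w₁ v +ℕ d1 xs))
      ≡⟨ cong (𝟙 (jLevel? v y) *_) (jSum-correct q ys (ψ ∘ (w₁ v +ℕ_))) ⟩
    𝟙 (jLevel? v y) * jSum q ys (ψ ∘ (w₁ v +ℕ_)) ∎
  jSum-correct {suc k} (free q) (y ∷ ys) ψ = begin
    ΣQ (free q) (λ x → 𝟙 (InJ? x (y ∷ ys)) * ψ (d1 x))
      ≡⟨ ΣQ-free q (λ x → 𝟙 (InJ? x (y ∷ ys)) * ψ (d1 x)) ⟩
    ΣF (suc s') (λ i → ΣQ q (λ xs → 𝟙 (InJ? (i ∷ xs) (y ∷ ys)) * ψ (d1 (i ∷ xs))))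
      ≡⟨ ΣL-cong (allFin (suc s')) (λ i → trans (restrictLevel i q ys y ψ)
                   (cong (𝟙 (jLevel? i y) *_) (jSum-correct q ys (ψ ∘ (w₁ i +ℕ_))))) ⟩
    ΣF (suc s') (λ i → 𝟙 (jLevel? i y) * jSum q ys (ψ ∘ (w₁ i +ℕ_)))
      ≡⟨ ΣF-suc s' (λ i → 𝟙 (jLevel? i y) * jSum q ys (ψ ∘ (w₁ i +ℕ_))) ⟩
    1ℤ * jSum q ys ψ + ΣF s' (λ i → 𝟙 (jLevel? (fs i) y) * jSum q ys (ψ ∘ suc))
      ≡⟨ cong₂ _+_ (ZP.*-identityˡ (jSum q ys ψ)) (otherLevels y) ⟩
    jSum q ys ψ + off1 y * jSum q ys (ψ ∘ suc) ∎
    where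
    X : ℤ
    X = jSum q ys (ψ ∘ suc)
    -- exactly one level ≠ 1 of x_i is compatible with y_i, and only when y_i ≠ 1
    otherLevels : ∀ y → ΣF s' (λ i → 𝟙 (jLevel? (fs i) y) * X) ≡ off1 y * X
    otherLevels fz = trans (ΣL-zero (allFin s') (λ i → 𝟙-false (λ { (inj₁ ()) ; (inj₂ ()) })
                                                              (jLevel? (fs i) fz) X))
                           (sym (ZP.*-zeroˡ X))
    otherLevels (fs y′) = begin
      ΣF s' (λ i → 𝟙 (jLevel? (fs i) (fs y′)) * X)
        ≡⟨ ΣL-cong (allFin s') (λ i → cong (_* X)
             (𝟙-⇔ (λ { (inj₁ ()) ; (inj₂ e) → sym (FP.suc-injective e) }) (λ e → inj₂ (cong fs (sym e)))
                  (jLevel? (fs i) (fs y′)) (i FP.≟ y′))) ⟩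
      ΣF s' (λ i → 𝟙 (i FP.≟ y′) * X)   ≡⟨ ΣF-δ s' y′ (λ _ → X) ⟩
      X                                 ≡⟨ sym (ZP.*-identityˡ X) ⟩
      1ℤ * X ∎

  -- The profile of a point y relative to a pattern q: `clash` if y differs from a level ≠ 1
  -- prescribed by q; otherwise `agree a b c`, where a counts the prescribed levels ≠ 1, b the
  -- coordinates prescribed to be 1 on which y ≠ 1, and c the free coordinates on which y ≠ 1.
  data Profile : Set where
    clash : Profile
    agree : ℕ → ℕ → ℕ → Profile

  bumpA bumpB bumpC : Profile → Profile
  bumpA clash = clash
  bumpA (agree a b c) = agree (suc a) b c
  bumpB clash = clash
  bumpB (agree a b c) = agree a (suc b) c
  bumpC clash = clash
  bumpC (agree a b c) = agree a b (suc c)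

  requireA : ∀ {p} {P : Set p} → Dec P → Profile → Profile
  requireA (yes _) P = bumpA P
  requireA (no _) P = clash

  profile : ∀ {k r} → Pattern (suc s') k r → Point (suc s') k → Profile
  profile end [] = agree 0 0 0
  profile (fix fz q) (fz ∷ ys) = profile q ys
  profile (fix fz q) (fs _ ∷ ys) = bumpB (profile q ys)
  profile (fix (fs v) q) (y ∷ ys) = requireA (y FP.≟ fs v) (profile q ys)
  profile (free q) (fz ∷ ys) = profile q ys
  profile (free q) (fs _ ∷ ys) = bumpC (profile q ys)

  -- The J-sum and the indicator of y ∈ q in terms of the profile: the x with y ∈ J_x are
  -- obtained by choosing j of the c free coordinates with y_i ≠ 1, and y matches q iff b = 0.
  jSumOf : Profile → (ℕ → ℤ) → ℤ
  jSumOf clash ψ = 0ℤ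
  jSumOf (agree a b c) ψ = binSum 1ℤ c (ψ ∘ (a +ℕ_))

  matchOf : Profile → ℤ
  matchOf clash = 0ℤ
  matchOf (agree a b c) = δ₀ b

  Consistent : ∀ {k} → Point (suc s') k → ℕ → Profile → Set
  Consistent y r clash = ⊤
  Consistent y r (agree a b c) = d1 y ≡ a +ℕ b +ℕ c × a +ℕ b ≤ r

  jSumOf-bumpA : ∀ P ψ → jSumOf (bumpA P) ψ ≡ jSumOf P (ψ ∘ suc)
  jSumOf-bumpA clash ψ = refl
  jSumOf-bumpA (agree a b c) ψ = refl

  jSumOf-bumpB : ∀ P ψ → jSumOf (bumpB P) ψ ≡ jSumOf P ψ
  jSumOf-bumpB clash ψ = refl
  jSumOf-bumpB (agree a b c) ψ = refl

  jSumOf-bumpC : ∀ P ψ → jSumOf (bumpC P) ψ ≡ jSumOf P ψ + 1ℤ * jSumOf P (ψ ∘ suc)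
  jSumOf-bumpC clash ψ = refl
  jSumOf-bumpC (agree a b c) ψ =
    cong (λ z → jSumOf (agree a b c) ψ + 1ℤ * z) (binSum-cong 1ℤ c (λ j → cong ψ (NP.+-suc a j)))

  matchOf-bumpA : ∀ P → matchOf (bumpA P) ≡ matchOf P
  matchOf-bumpA clash = refl
  matchOf-bumpA (agree a b c) = refl

  matchOf-bumpB : ∀ P → matchOf (bumpB P) ≡ 0ℤ
  matchOf-bumpB clash = refl
  matchOf-bumpB (agree a b c) = refl

  matchOf-bumpC : ∀ P → matchOf (bumpC P) ≡ matchOf P
  matchOf-bumpC clash = refl
  matchOf-bumpC (agree a b c) = refl

  jSum-profile : ∀ {k r} (q : Pattern (suc s') k r) y ψ → jSum q y ψ ≡ jSumOf (profile q y) ψ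
  jSum-profile end [] ψ = refl
  jSum-profile (fix fz q) (fz ∷ ys) ψ =
    trans (𝟙-true (inj₁ refl) (jLevel? fz fz) _) (jSum-profile q ys ψ)
  jSum-profile (fix fz q) (fs y ∷ ys) ψ =
    trans (𝟙-true (inj₁ refl) (jLevel? fz (fs y)) _)
          (trans (jSum-profile q ys ψ) (sym (jSumOf-bumpB (profile q ys) ψ)))
  jSum-profile (fix (fs v) q) (y ∷ ys) ψ = byLevel (y FP.≟ fs v)
    where
    byLevel : (d : Dec (y ≡ fs v)) →
      𝟙 (jLevel? (fs v) y) * jSum q ys (ψ ∘ suc) ≡ jSumOf (requireA d (profile q ys)) ψ
    byLevel (yes e) = trans (𝟙-true (inj₂ e) (jLevel? (fs v) y) _)
      (trans (jSum-profile q ys (ψ ∘ suc)) (sym (jSumOf-bumpA (profile q ys) ψ)))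
    byLevel (no ne) = 𝟙-false (λ { (inj₁ ()) ; (inj₂ e) → ne e }) (jLevel? (fs v) y) _
  jSum-profile (free q) (fz ∷ ys) ψ =
    trans (cong (_+_ (jSum q ys ψ)) (ZP.*-zeroˡ (jSum q ys (ψ ∘ suc))))
          (trans (ZP.+-identityʳ _) (jSum-profile q ys ψ))
  jSum-profile (free q) (fs y ∷ ys) ψ =
    trans (cong₂ (λ u v → u + 1ℤ * v) (jSum-profile q ys ψ) (jSum-profile q ys (ψ ∘ suc)))
          (sym (jSumOf-bumpC (profile q ys) ψ))

  match-profile : ∀ {k r} (q : Pattern (suc s') k r) y → 𝟙 (match? q y) ≡ matchOf (profile q y)
  match-profile end [] = refl
  match-profile (fix fz q) (fz ∷ ys) =
    trans (𝟙-× (fz FP.≟ fz) (match? q ys)) (trans (ZP.*-identityˡ _) (match-profile q ys))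
  match-profile (fix fz q) (fs y ∷ ys) =
    trans (𝟙-× (fs y FP.≟ fz) (match? q ys))
          (trans (ZP.*-zeroˡ (𝟙 (match? q ys))) (sym (matchOf-bumpB (profile q ys))))
  match-profile (fix (fs v) q) (y ∷ ys) with y FP.≟ fs v
  ... | yes e = trans (𝟙-× (yes e) (match? q ys))
                  (trans (ZP.*-identityˡ _) (trans (match-profile q ys) (sym (matchOf-bumpA (profile q ys)))))
  ... | no _ = refl
  match-profile (free q) (fz ∷ ys) = match-profile q ys
  match-profile (free q) (fs y ∷ ys) = trans (match-profile q ys) (sym (matchOf-bumpC (profile q ys)))

  profile-consistent : ∀ {k r} (q : Pattern (suc s') k r) y → Consistent y r (profile q y)
  profile-consistent end [] = refl , z≤n
  profile-consistent (fix fz q) (fz ∷ ys) = extraFixed (profile q ys) (profile-consistent q ys)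
    where
    extraFixed : ∀ {r} P → Consistent ys r P → Consistent (fz ∷ ys) (suc r) P
    extraFixed clash _ = tt
    extraFixed (agree a b c) (w≡ , a+b≤r) = w≡ , NP.m≤n⇒m≤1+n a+b≤r
  profile-consistent (fix fz q) (fs y ∷ ys) = countB (profile q ys) (profile-consistent q ys)
    where
    countB : ∀ {r} P → Consistent ys r P → Consistent (fs y ∷ ys) (suc r) (bumpB P)
    countB clash _ = tt
    countB {r} (agree a b c) (w≡ , a+b≤r) =
      trans (cong suc w≡) (cong (_+ℕ c) (sym (NP.+-suc a b))) ,
      subst (_≤ suc r) (sym (NP.+-suc a b)) (s≤s a+b≤r)
  profile-consistent (fix (fs v) q) (y ∷ ys) with y FP.≟ fs v
  ... | yes refl = countA (profile q ys) (profile-consistent q ys)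
    where
    countA : ∀ {r} P → Consistent ys r P → Consistent (fs v ∷ ys) (suc r) (bumpA P)
    countA clash _ = tt
    countA (agree a b c) (w≡ , a+b≤r) = cong suc w≡ , s≤s a+b≤r
  ... | no _ = tt
  profile-consistent (free q) (fz ∷ ys) = sameWeight (profile q ys) (profile-consistent q ys)
    where
    sameWeight : ∀ {r} P → Consistent ys r P → Consistent (fz ∷ ys) r P
    sameWeight clash _ = tt
    sameWeight (agree a b c) consistent = consistent
  profile-consistent (free q) (fs y ∷ ys) = countC (profile q ys) (profile-consistent q ys)
    where
    countC : ∀ {r} P → Consistent ys r P → Consistent (fs y ∷ ys) r (bumpC P)
    countC clash _ = tt
    countC (agree a b c) (w≡ , a+b≤r) = trans (cong suc w≡) (sym (NP.+-suc (a +ℕ b) c)) , a+b≤r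

  -- For heavy y, its own indicator and its J-sum against the coefficients κ cancel on every
  -- t-subcube; this is `heavyCancellation` read through the profile of y.
  subcubeCancellation : ∀ {k t} (q : Pattern (suc s') k t) (y : Point (suc s') k) → t < d1 y →
    𝟙 (match? q y) + jSum q y (κ t (d1 y)) ≡ 0ℤ
  subcubeCancellation {t = t} q y t<w =
    trans (cong₂ _+_ (match-profile q y) (jSum-profile q y (κ t (d1 y))))
          (byProfile (profile q y) (profile-consistent q y))
    where
    byProfile : ∀ P → Consistent y t P → matchOf P + jSumOf P (κ t (d1 y)) ≡ 0ℤ
    byProfile clash _ = refl
    byProfile (agree a b c) (w≡ , a+b≤t) = heavyCancellation a b c t (d1 y) w≡ a+b≤t t<w

module Completion (s' k t lam : ℕ) (N : Point (suc s') k → ℤ) where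
  open PointSums (suc s')
  open Subcubes s'
  open Sequence lam (suc s') k t

  constraint : Point (suc s') k → ℤ
  constraint = constraintLHS lam (suc s') k t N

  completion : Point (suc s') k → ℤ
  completion x = 𝟙 (d1 x ≤? t) * constraint x + 𝟙 (t <? d1 x) * N x

  completion-light : ∀ x → d1 x ≤ t → completion x ≡ constraint x
  completion-light x light = begin
    𝟙 (d1 x ≤? t) * constraint x + 𝟙 (t <? d1 x) * N x
      ≡⟨ cong₂ _+_ (𝟙-true light (d1 x ≤? t) _) (𝟙-false (NP.≤⇒≯ light) (t <? d1 x) _) ⟩
    constraint x + 0ℤ  ≡⟨ ZP.+-identityʳ _ ⟩
    constraint x       ∎

  completion-heavy : ∀ x → t < d1 x → completion x ≡ N x
  completion-heavy x heavy = begin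
    𝟙 (d1 x ≤? t) * constraint x + 𝟙 (t <? d1 x) * N x
      ≡⟨ cong₂ _+_ (𝟙-false (NP.<⇒≱ heavy) (d1 x ≤? t) _) (𝟙-true heavy (t <? d1 x) _) ⟩
    0ℤ + N x  ≡⟨ ZP.+-identityˡ _ ⟩
    N x       ∎

  completion-nonneg : (∀ x → d1 x ≤ t → 0ℤ ℤ.≤ constraint x) → (∀ y → t < d1 y → 0ℤ ℤ.≤ N y) →
    ∀ x → 0ℤ ℤ.≤ completion x
  completion-nonneg lightOK heavyOK x = byWeight (t <? d1 x)
    where
    byWeight : Dec (t < d1 x) → 0ℤ ℤ.≤ completion x
    byWeight (yes heavy) = subst (0ℤ ℤ.≤_) (sym (completion-heavy x heavy)) (heavyOK x heavy)
    byWeight (no light) =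
      subst (0ℤ ℤ.≤_) (sym (completion-light x (NP.≮⇒≥ light))) (lightOK x (NP.≮⇒≥ light))

  heavyN : Point (suc s') k → ℤ
  heavyN y = 𝟙 (t <? d1 y) * N y

  base coupling : Point (suc s') k → ℤ
  base x = 𝟙 (d1 x ≤? t) * a (t ∸ d1 x)
  coupling x = ΣP k (λ y → heavyN y * (𝟙 (InJ? x y) * κ t (d1 y) (d1 x)))

  completion-parts : ∀ x → completion x ≡ base x + (coupling x + heavyN x)
  completion-parts x = begin
    completion x
      ≡⟨ cong (λ z → 𝟙 (d1 x ≤? t) * (a (t ∸ d1 x) + sgn * z) + heavyN x)
              (ΣL-filter (λ y → InJ? x y ×-dec (t <? d1 y)) (allPoints (suc s') k) (λ y → binom y * N y)) ⟩
    𝟙 (d1 x ≤? t) * (a (t ∸ d1 x) + sgn * ΣP k (λ y → 𝟙 (InJ? x y ×-dec (t <? d1 y)) * (binom y * N y)))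
      + heavyN x
      ≡⟨ cong (λ z → 𝟙 (d1 x ≤? t) * (a (t ∸ d1 x) + z) + heavyN x) (sym (ΣP-* k sgn _)) ⟩
    𝟙 (d1 x ≤? t) * (a (t ∸ d1 x) + ΣP k (λ y → sgn * (𝟙 (InJ? x y ×-dec (t <? d1 y)) * (binom y * N y))))
      + heavyN x
      ≡⟨ cong (λ z → z + heavyN x) (ZP.*-distribˡ-+ (𝟙 (d1 x ≤? t)) _ _) ⟩
    base x + 𝟙 (d1 x ≤? t) * ΣP k (λ y → sgn * (𝟙 (InJ? x y ×-dec (t <? d1 y)) * (binom y * N y)))
      + heavyN x
      ≡⟨ cong (λ z → base x + z + heavyN x) (trans (sym (ΣP-* k (𝟙 (d1 x ≤? t)) _)) (ΣP-cong k pairTerm)) ⟩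
    base x + coupling x + heavyN x
      ≡⟨ ZP.+-assoc (base x) (coupling x) (heavyN x) ⟩
    base x + (coupling x + heavyN x) ∎
    where
    sgn : ℤ
    sgn = -1ℤ ^ (t ∸ d1 x +ℕ 1)
    binom : Point (suc s') k → ℤ
    binom y = + ((d1 y ∸ d1 x ∸ 1) C (t ∸ d1 x))
    pairTerm : ∀ y → 𝟙 (d1 x ≤? t) * (sgn * (𝟙 (InJ? x y ×-dec (t <? d1 y)) * (binom y * N y)))
                   ≡ heavyN y * (𝟙 (InJ? x y) * κ t (d1 y) (d1 x))
    pairTerm y rewrite 𝟙-× (InJ? x y) (t <? d1 y) =
      rearrange (𝟙 (d1 x ≤? t)) sgn (𝟙 (InJ? x y)) (𝟙 (t <? d1 y)) (binom y) (N y)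
      where
      rearrange : ∀ l g j h c n → l * (g * (j * h * (c * n))) ≡ h * n * (j * (l * (g * c)))
      rearrange = solve-∀

  module _ (q : Pattern (suc s') k t) where
    -- The constant terms sum to λ over the subcube: the convolution identity of a_c.
    baseSum : ΣQ q base ≡ + lam
    baseSum = begin
      ΣQ q base
        ≡⟨ weightSum q (λ w → 𝟙 (w ≤? t) * a (t ∸ w)) ⟩
      binSum (+ s') (freeCount q) shifted
        ≡⟨ cong (λ n → binSum (+ s') n shifted) (freeCount-∸ q) ⟩
      binSum (+ s') (k ∸ t) shifted
        ≡⟨ binSum-cong (+ s') (k ∸ t) shiftByFixed ⟩
      binSum (+ s') (k ∸ t) (λ j → 𝟙 (j ≤? t ∸ f) * a (t ∸ f ∸ j))
        ≡⟨ aConvolution (t ∸ f) ⟩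
      + lam ∎
      where
      f : ℕ
      f = fixedWeight q
      shifted : ℕ → ℤ
      shifted j = 𝟙 (f +ℕ j ≤? t) * a (t ∸ (f +ℕ j))
      shiftByFixed : ∀ j → 𝟙 (f +ℕ j ≤? t) * a (t ∸ (f +ℕ j)) ≡ 𝟙 (j ≤? t ∸ f) * a (t ∸ f ∸ j)
      shiftByFixed j = cong₂ _*_
        (𝟙-⇔ (λ le → subst (_≤ t ∸ f) (NP.m+n∸m≡n f j) (NP.∸-monoˡ-≤ f le))
             (λ le → subst (f +ℕ j ≤_) (NP.m+[n∸m]≡n (fixedWeight≤ q)) (NP.+-monoʳ-≤ f le))
             (f +ℕ j ≤? t) (j ≤? t ∸ f))
        (cong a (sym (NP.∸-+-assoc t f j)))

    couplingSum : ΣQ q coupling ≡ ΣP k (λ y → heavyN y * jSum q y (κ t (d1 y)))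
    couplingSum = begin
      ΣP k (λ x → 𝟙 (match? q x) * coupling x)
        ≡⟨ ΣP-cong k (λ x → sym (ΣP-* k (𝟙 (match? q x)) _)) ⟩
      ΣP k (λ x → ΣP k (λ y → 𝟙 (match? q x) * (heavyN y * (𝟙 (InJ? x y) * κ t (d1 y) (d1 x)))))
        ≡⟨ ΣL-swap (allPoints (suc s') k) (allPoints (suc s') k) _ ⟩
      ΣP k (λ y → ΣP k (λ x → 𝟙 (match? q x) * (heavyN y * (𝟙 (InJ? x y) * κ t (d1 y) (d1 x)))))
        ≡⟨ ΣP-cong k (λ y → trans (ΣP-cong k (λ x → commute (𝟙 (match? q x)) (heavyN y) _))
                                  (ΣP-* k (heavyN y) _)) ⟩
      ΣP k (λ y → heavyN y * ΣQ q (λ x → 𝟙 (InJ? x y) * κ t (d1 y) (d1 x)))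
        ≡⟨ ΣP-cong k (λ y → cong (heavyN y *_) (jSum-correct q y (κ t (d1 y)))) ⟩
      ΣP k (λ y → heavyN y * jSum q y (κ t (d1 y))) ∎
      where
      commute : ∀ m h p → m * (h * p) ≡ h * (m * p)
      commute = solve-∀

    -- Each heavy y contributes N_y (𝟙[y ∈ q] + its J-sum) = 0.
    heavySum : ΣQ q coupling + ΣQ q heavyN ≡ 0ℤ
    heavySum = begin
      ΣQ q coupling + ΣQ q heavyN
        ≡⟨ cong₂ _+_ couplingSum (ΣP-cong k (λ y → ZP.*-comm (𝟙 (match? q y)) (heavyN y))) ⟩
      ΣP k (λ y → heavyN y * jSum q y (κ t (d1 y))) + ΣP k (λ y → heavyN y * 𝟙 (match? q y))
        ≡⟨ sym (ΣP-+ k _ _) ⟩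
      ΣP k (λ y → heavyN y * jSum q y (κ t (d1 y)) + heavyN y * 𝟙 (match? q y))
        ≡⟨ ΣP-zero k vanishes ⟩
      0ℤ ∎
      where
      vanishes : ∀ y → heavyN y * jSum q y (κ t (d1 y)) + heavyN y * 𝟙 (match? q y) ≡ 0ℤ
      vanishes y with t <? d1 y
      ... | yes heavy = begin
        1ℤ * N y * jSum q y (κ t (d1 y)) + 1ℤ * N y * 𝟙 (match? q y)
          ≡⟨ sym (ZP.*-distribˡ-+ (1ℤ * N y) _ _) ⟩
        1ℤ * N y * (jSum q y (κ t (d1 y)) + 𝟙 (match? q y))
          ≡⟨ cong (1ℤ * N y *_) (trans (ZP.+-comm _ (𝟙 (match? q y))) (subcubeCancellation q y heavy)) ⟩
        1ℤ * N y * 0ℤ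
          ≡⟨ ZP.*-zeroʳ (1ℤ * N y) ⟩
        0ℤ ∎
      ... | no _ = cong₂ _+_ (ZP.*-zeroˡ (jSum q y (κ t (d1 y)))) (ZP.*-zeroˡ (𝟙 (match? q y)))

    subcubeSum-completion : ΣQ q completion ≡ + lam
    subcubeSum-completion = begin
      ΣQ q completion
        ≡⟨ ΣQ-cong q completion-parts ⟩
      ΣQ q (λ x → base x + (coupling x + heavyN x))
        ≡⟨ ΣQ-+ q base (λ x → coupling x + heavyN x) ⟩
      ΣQ q base + ΣQ q (λ x → coupling x + heavyN x)
        ≡⟨ cong₂ _+_ baseSum (trans (ΣQ-+ q coupling heavyN) heavySum) ⟩
      + lam + 0ℤ
        ≡⟨ ZP.+-identityʳ (+ lam) ⟩
      + lam ∎

refine : ∀ {s k r} → Pattern s k r → r < k → Fin s → Pattern s k (suc r)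
refine (fix w q) (s≤s r<k) v = fix w (refine q r<k v)
refine (free q) _ v = fix v q

allFree : ∀ {s} k → Pattern s k 0
allFree zero = end
allFree (suc k) = free (allFree k)

match-allFree : ∀ {s} k (x : Point s k) → Match (allFree k) x
match-allFree zero [] = tt
match-allFree (suc k) (x ∷ xs) = match-allFree k xs

module Coarsening (s : ℕ) where
  open PointSums s

  ΣQ-refine : ∀ {k r} (q : Pattern s k r) (r<k : r < k) (F : Point s k → ℤ) →
    ΣQ q F ≡ ΣF s (λ v → ΣQ (refine q r<k v) F)
  ΣQ-refine (fix w q) (s≤s r<k) F =
    trans (ΣQ-fix w q F)
    (trans (ΣQ-refine q r<k (λ xs → F (w ∷ xs)))
           (ΣL-cong (allFin s) (λ v → sym (ΣQ-fix w (refine q r<k v) F))))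
  ΣQ-refine (free q) _ F = trans (ΣQ-free q F) (ΣL-cong (allFin s) (λ v → sym (ΣQ-fix v q F)))

  coarserSubcubeSum : ∀ {k t lam} (F : Point s k → ℤ) → t ≤ k →
    (∀ (q : Pattern s k t) → ΣQ q F ≡ + lam) →
    ∀ n r (q : Pattern s k r) → r +ℕ n ≡ t → ΣQ q F ≡ + (lam *ℕ s ^ℕ n)
  coarserSubcubeSum {lam = lam} F t≤k sums zero r q r+0≡t
    with trans (sym (NP.+-identityʳ r)) r+0≡t
  ... | refl = trans (sums q) (cong +_ (sym (NP.*-identityʳ lam)))
  coarserSubcubeSum {k} {t} {lam} F t≤k sums (suc n) r q r+n+1≡t = begin
    ΣQ q F
      ≡⟨ ΣQ-refine q r<k F ⟩
    ΣF s (λ v → ΣQ (refine q r<k v) F)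
      ≡⟨ ΣL-cong (allFin s) (λ v → coarserSubcubeSum F t≤k sums n (suc r) (refine q r<k v)
                                     (trans (sym (NP.+-suc r n)) r+n+1≡t)) ⟩
    ΣF s (λ _ → + (lam *ℕ s ^ℕ n))
      ≡⟨ ΣF-const s (+ (lam *ℕ s ^ℕ n)) ⟩
    + s * + (lam *ℕ s ^ℕ n)
      ≡⟨ sym (ZP.pos-* s (lam *ℕ s ^ℕ n)) ⟩
    + (s *ℕ (lam *ℕ s ^ℕ n))
      ≡⟨ cong +_ (swapFactors s lam (s ^ℕ n)) ⟩
    + (lam *ℕ s ^ℕ suc n) ∎
    where
    swapFactors : ∀ a b c → a *ℕ (b *ℕ c) ≡ b *ℕ (a *ℕ c)
    swapFactors a b c = trans (sym (NP.*-assoc a b c))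
                          (trans (cong (_*ℕ c) (NP.*-comm a b)) (NP.*-assoc b a c))
    r<k : r < k
    r<k = NP.<-≤-trans (subst (r <_) r+n+1≡t (NP.m<m+n r (s≤s z≤n))) t≤k

  totalSum : ∀ {k t lam} (F : Point s k → ℤ) → t ≤ k →
    (∀ (q : Pattern s k t) → ΣQ q F ≡ + lam) → ΣP k F ≡ + (lam *ℕ s ^ℕ t)
  totalSum {k} {t} F t≤k sums =
    trans (ΣP-cong k (λ x → sym (𝟙-true (match-allFree k x) (match? (allFree k) x) (F x))))
          (coarserSubcubeSum F t≤k sums t 0 (allFree k) refl)

OnColumns : ∀ {s k t} → (Fin t → Fin k) → (Fin t → Fin s) → Point s k → Set
OnColumns c u x = ∀ j → lookup x (c j) ≡ u j

Describes : ∀ {s k t} → (Fin t → Fin k) → (Fin t → Fin s) → Pattern s k t → Set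
Describes {s} {k} c u q = ∀ (x : Point s k) → (OnColumns c u x → Match q x) × (Match q x → OnColumns c u x)

columnsOf : ∀ {s k r} → Pattern s k r → Fin r → Fin k
columnsOf (fix v q) fz = fz
columnsOf (fix v q) (fs j) = fs (columnsOf q j)
columnsOf (free q) j = fs (columnsOf q j)

levelsOf : ∀ {s k r} → Pattern s k r → Fin r → Fin s
levelsOf (fix v q) fz = v
levelsOf (fix v q) (fs j) = levelsOf q j
levelsOf (free q) j = levelsOf q j

columnsOf-injective : ∀ {s k r} (q : Pattern s k r) → Injective _≡_ _≡_ (columnsOf q)
columnsOf-injective (fix v q) {fz} {fz} e = refl
columnsOf-injective (fix v q) {fz} {fs j} ()
columnsOf-injective (fix v q) {fs i} {fz} ()
columnsOf-injective (fix v q) {fs i} {fs j} e = cong fs (columnsOf-injective q (FP.suc-injective e))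
columnsOf-injective (free q) e = columnsOf-injective q (FP.suc-injective e)

describes-self : ∀ {s k r} (q : Pattern s k r) → Describes (columnsOf q) (levelsOf q) q
describes-self end [] = (λ _ → tt) , (λ _ ())
describes-self (fix v q) (x ∷ xs) =
  (λ on → on fz , proj₁ (describes-self q xs) (on ∘ fs)) ,
  (λ { (x≡v , m) fz → x≡v ; (x≡v , m) (fs j) → proj₂ (describes-self q xs) m j })
describes-self (free q) (x ∷ xs) = describes-self q xs

lookup-punchOut : ∀ {ℓ} {A : Set ℓ} {k} {i : Fin (suc k)} (x : A) (xs : Vec A k) (i≢0 : fz ≢ i) →
  lookup (x ∷ xs) i ≡ lookup xs (punchOut i≢0)
lookup-punchOut {i = fz} x xs i≢0 = ⊥-elim (i≢0 refl)
lookup-punchOut {i = fs i} x xs i≢0 = refl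

patternFor : ∀ {s} k t (c : Fin t → Fin k) → Injective _≡_ _≡_ c → (u : Fin t → Fin s) →
  Σ (Pattern s k t) (Describes c u)

patternFor-first : ∀ {s} k t (c : Fin (suc t) → Fin (suc k)) → Injective _≡_ _≡_ c →
  (u : Fin (suc t) → Fin s) (j₀ : Fin (suc t)) → c j₀ ≡ fz →
  Σ (Pattern s (suc k) (suc t)) (Describes c u)
patternFor-first {s} k t c inj u j₀ c-j₀ = fix (u j₀) q , describes
  where
  notFirst : ∀ j → fz ≢ c (punchIn j₀ j)
  notFirst j e = FP.punchInᵢ≢i j₀ j (inj (trans (sym e) (sym c-j₀)))
  c′ : Fin t → Fin k
  c′ j = punchOut (notFirst j)
  inj′ : Injective _≡_ _≡_ c′
  inj′ {i} {j} e = FP.punchIn-injective j₀ i j (inj (FP.punchOut-injective (notFirst i) (notFirst j) e))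
  rest : Σ (Pattern s k t) (Describes c′ (u ∘ punchIn j₀))
  rest = patternFor k t c′ inj′ (u ∘ punchIn j₀)
  q : Pattern s k t
  q = proj₁ rest
  describes : Describes c u (fix (u j₀) q)
  describes (x ∷ xs) = to , from
    where
    to : OnColumns c u (x ∷ xs) → Match (fix (u j₀) q) (x ∷ xs)
    to on = trans (sym (cong (lookup (x ∷ xs)) c-j₀)) (on j₀) ,
            proj₁ (proj₂ rest xs) (λ j → trans (sym (lookup-punchOut x xs (notFirst j))) (on (punchIn j₀ j)))
    from : Match (fix (u j₀) q) (x ∷ xs) → OnColumns c u (x ∷ xs)
    from (x≡u , m) j with j₀ FP.≟ j
    ... | yes refl = trans (cong (lookup (x ∷ xs)) c-j₀) x≡u
    ... | no j₀≢j = subst (λ i → lookup (x ∷ xs) (c i) ≡ u i) (FP.punchIn-punchOut j₀≢j)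
                      (trans (lookup-punchOut x xs (notFirst (punchOut j₀≢j)))
                             (proj₂ (proj₂ rest xs) m (punchOut j₀≢j)))

patternFor-skip : ∀ {s} k t (c : Fin t → Fin (suc k)) → Injective _≡_ _≡_ c →
  (u : Fin t → Fin s) → (∀ j → fz ≢ c j) → Σ (Pattern s (suc k) t) (Describes c u)
patternFor-skip {s} k t c inj u notFirst = free (proj₁ rest) , describes
  where
  c′ : Fin t → Fin k
  c′ j = punchOut (notFirst j)
  rest : Σ (Pattern s k t) (Describes c′ u)
  rest = patternFor k t c′ (λ {i} {j} e → inj (FP.punchOut-injective (notFirst i) (notFirst j) e)) u
  describes : Describes c u (free (proj₁ rest))
  describes (x ∷ xs) =
    (λ on → proj₁ (proj₂ rest xs) (λ j → trans (sym (lookup-punchOut x xs (notFirst j))) (on j))) ,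
    (λ m j → trans (lookup-punchOut x xs (notFirst j)) (proj₂ (proj₂ rest xs) m j))

patternFor zero zero c inj u = end , λ { [] → (λ _ → tt) , (λ _ ()) }
patternFor zero (suc t) c inj u with c fz
... | ()
patternFor (suc k) t c inj u with FP.any? (λ j → c j FP.≟ fz)
patternFor (suc k) zero c inj u | yes (() , _)
patternFor (suc k) (suc t) c inj u | yes (j₀ , c-j₀) = patternFor-first k t c inj u j₀ c-j₀
patternFor (suc k) t c inj u | no none = patternFor-skip k t c inj u (λ j e → none (j , sym e))

projection⇔ : ∀ {s k t} (x : Point s k) (c : Fin t → Fin k) (u : Vec (Fin s) t) →
  (tabulate (λ j → lookup x (c j)) ≡ u → OnColumns c (lookup u) x) ×
  (OnColumns c (lookup u) x → tabulate (λ j → lookup x (c j)) ≡ u)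
projection⇔ x c u =
  (λ e j → trans (sym (VP.lookup∘tabulate (λ j → lookup x (c j)) j)) (cong (λ v → lookup v j) e)) ,
  (λ on → trans (VP.tabulate-cong on) (VP.tabulate∘lookup u))

module _ {ℓ p} {A : Set ℓ} {P : A → Set p} (P? : ∀ x → Dec (P x)) where
  count-∷ : ∀ x {n} (xs : Vec A n) → + count P? (x ∷ xs) ≡ 𝟙 (P? x) + + count P? xs
  count-∷ x xs with P? x
  ... | yes _ = refl
  ... | no _ = sym (ZP.+-identityˡ _)

  count-++ : ∀ {n m} (xs : Vec A n) (ys : Vec A m) →
    + count P? (xs V.++ ys) ≡ + count P? xs + + count P? ys
  count-++ [] ys = sym (ZP.+-identityˡ _)
  count-++ (x ∷ xs) ys = begin
    + count P? (x ∷ xs V.++ ys)             ≡⟨ count-∷ x (xs V.++ ys) ⟩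
    𝟙 (P? x) + + count P? (xs V.++ ys)      ≡⟨ cong (_+_ (𝟙 (P? x))) (count-++ xs ys) ⟩
    𝟙 (P? x) + (+ count P? xs + + count P? ys) ≡⟨ sym (ZP.+-assoc (𝟙 (P? x)) _ _) ⟩
    𝟙 (P? x) + + count P? xs + + count P? ys  ≡⟨ cong (_+ + count P? ys) (sym (count-∷ x xs)) ⟩
    + count P? (x ∷ xs) + + count P? ys     ∎

  count-replicate : ∀ n x → + count P? (replicate n x) ≡ 𝟙 (P? x) * + n
  count-replicate zero x = sym (ZP.*-zeroʳ (𝟙 (P? x)))
  count-replicate (suc n) x =
    trans (count-∷ x (replicate n x))
      (trans (cong (_+_ (𝟙 (P? x))) (count-replicate n x)) (oneMore (𝟙 (P? x)) (+ n)))
    where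
    oneMore : ∀ i m → i + i * m ≡ i * (1ℤ + m)
    oneMore = solve-∀

  count-subst : ∀ {n m} (e : n ≡ m) (v : Vec A n) → count P? (subst (Vec A) e v) ≡ count P? v
  count-subst refl v = refl

count-⇔ : ∀ {ℓ p q} {A : Set ℓ} {P : A → Set p} {Q : A → Set q}
  (P? : ∀ x → Dec (P x)) (Q? : ∀ x → Dec (Q x)) →
  (∀ x → P x → Q x) → (∀ x → Q x → P x) → ∀ {n} (v : Vec A n) → count P? v ≡ count Q? v
count-⇔ P? Q? f g [] = refl
count-⇔ P? Q? f g (x ∷ v) with P? x | Q? x
... | yes _ | yes _ = cong suc (count-⇔ P? Q? f g v)
... | no _ | no _ = count-⇔ P? Q? f g v
... | yes p | no ¬q = ⊥-elim (¬q (f x p))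
... | no ¬p | yes q = ⊥-elim (¬p (g x q))

sumℕ : ∀ {ℓ} {A : Set ℓ} → (A → ℕ) → List A → ℕ
sumℕ g L.[] = 0
sumℕ g (x L.∷ xs) = g x +ℕ sumℕ g xs

rowsOf : ∀ {ℓ} {A : Set ℓ} (g : A → ℕ) (xs : List A) → Vec A (sumℕ g xs)
rowsOf g L.[] = []
rowsOf g (x L.∷ xs) = replicate (g x) x V.++ rowsOf g xs

sumℕ-ΣL : ∀ {ℓ} {A : Set ℓ} (g : A → ℕ) xs → + sumℕ g xs ≡ ΣL xs (λ x → + g x)
sumℕ-ΣL g L.[] = refl
sumℕ-ΣL g (x L.∷ xs) = trans (ZP.pos-+ (g x) (sumℕ g xs)) (cong (_+_ (+ g x)) (sumℕ-ΣL g xs))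

count-rowsOf : ∀ {ℓ p} {A : Set ℓ} {P : A → Set p} (P? : ∀ x → Dec (P x)) (g : A → ℕ) xs →
  + count P? (rowsOf g xs) ≡ ΣL xs (λ x → 𝟙 (P? x) * + g x)
count-rowsOf P? g L.[] = refl
count-rowsOf P? g (x L.∷ xs) = trans (count-++ P? (replicate (g x) x) (rowsOf g xs))
  (cong₂ _+_ (count-replicate P? (g x) x) (count-rowsOf P? g xs))

module Multiplicity (s : ℕ) where
  open PointSums s

  mult : ∀ {k n} → Vec (Point s k) n → Point s k → ℤ
  mult A x = + count (_≟P x) A

  count-mult : ∀ {k p} {P : Point s k → Set p} (P? : ∀ x → Dec (P x)) {n} (A : Vec (Point s k) n) →
    + count P? A ≡ ΣP k (λ x → 𝟙 (P? x) * mult A x)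
  count-mult {k} P? [] = sym (ΣP-zero k (λ x → ZP.*-zeroʳ (𝟙 (P? x))))
  count-mult {k} P? (r ∷ A) = begin
    + count P? (r ∷ A)
      ≡⟨ count-∷ P? r A ⟩
    𝟙 (P? r) + + count P? A
      ≡⟨ cong₂ _+_ (sym (trans (ΣP-cong k (λ x → trans (ZP.*-comm (𝟙 (P? x)) (𝟙 (r ≟P x))) (flip x)))
                                (ΣP-δ k r (λ x → 𝟙 (P? x)))))
                   (count-mult P? A) ⟩
    ΣP k (λ x → 𝟙 (P? x) * 𝟙 (r ≟P x)) + ΣP k (λ x → 𝟙 (P? x) * mult A x)
      ≡⟨ sym (ΣP-+ k _ _) ⟩
    ΣP k (λ x → 𝟙 (P? x) * 𝟙 (r ≟P x) + 𝟙 (P? x) * mult A x)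
      ≡⟨ ΣP-cong k (λ x → trans (sym (ZP.*-distribˡ-+ (𝟙 (P? x)) _ _))
                                (cong (𝟙 (P? x) *_) (sym (count-∷ (_≟P x) r A)))) ⟩
    ΣP k (λ x → 𝟙 (P? x) * mult (r ∷ A) x) ∎
    where
    flip : ∀ x → 𝟙 (r ≟P x) * 𝟙 (P? x) ≡ 𝟙 (x ≟P r) * 𝟙 (P? x)
    flip x = cong (_* 𝟙 (P? x)) (𝟙-⇔ sym sym (r ≟P x) (x ≟P r))

  mult-rowsOf : ∀ {k} (g : Point s k → ℕ) x → mult (rowsOf g (allPoints s k)) x ≡ + g x
  mult-rowsOf {k} g x = trans (count-rowsOf (_≟P x) g (allPoints s k)) (ΣP-δ k x (λ y → + g y))

  count-subcube : ∀ {k r} (q : Pattern s k r) {n} (A : Vec (Point s k) n) →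
    + count (match? q) A ≡ ΣQ q (mult A)
  count-subcube q = count-mult (match? q)

Isolating : ∀ {s k} → Point s k → ℕ → Set
Isolating {s} {k} x e = Σ ℕ λ r → (r ≡ d1 x +ℕ e) ×
  Σ (Pattern s k r) (λ q → Match q x × (∀ z → Match q z → z ≢ x → d1 x < d1 z))

-- Prescribe every coordinate where x ≠ 1 and the first e coordinates where x = 1: another
-- point of the subcube has a level ≠ 1 on some free coordinate, where x has level 1.
isolating : ∀ {s' k} (x : Point (suc s') k) (e : ℕ) → d1 x +ℕ e ≤ k → Isolating x e
isolating [] zero _ = 0 , refl , end , tt , λ { [] _ z≢x → ⊥-elim (z≢x refl) }
isolating (fs v ∷ xs) e (s≤s room) with isolating xs e room
... | r , r≡ , q , x∈q , heavier = suc r , cong suc r≡ , fix (fs v) q , (refl , x∈q) , heavier′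
  where
  heavier′ : ∀ z → Match (fix (fs v) q) z → z ≢ fs v ∷ xs → suc (d1 xs) < d1 z
  heavier′ (z ∷ zs) (refl , zs∈q) z≢x = s≤s (heavier zs zs∈q (λ e → z≢x (cong (fs v ∷_) e)))
isolating {k = suc k} (fz ∷ xs) zero _
  with isolating xs zero (subst (_≤ k) (sym (NP.+-identityʳ (d1 xs))) (VP.count≤n _ xs))
... | r , r≡ , q , x∈q , heavier = r , r≡ , free q , x∈q , heavier′
  where
  heavier′ : ∀ z → Match (free q) z → z ≢ fz ∷ xs → d1 xs < d1 z
  heavier′ (fz ∷ zs) zs∈q z≢x = heavier zs zs∈q (λ e → z≢x (cong (fz ∷_) e))
  heavier′ (fs w ∷ zs) zs∈q z≢x with zs ≟P xs
  ... | yes refl = s≤s NP.≤-refl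
  ... | no zs≢xs = s≤s (NP.<⇒≤ (heavier zs zs∈q zs≢xs))
isolating {k = suc k} (fz ∷ xs) (suc e) room
  with isolating xs e (NP.≤-pred (subst (_≤ suc k) (NP.+-suc (d1 xs) e) room))
... | r , r≡ , q , x∈q , heavier =
  suc r , trans (cong suc r≡) (sym (NP.+-suc (d1 xs) e)) , fix fz q , (refl , x∈q) , heavier′
  where
  heavier′ : ∀ z → Match (fix fz q) z → z ≢ fz ∷ xs → d1 xs < d1 z
  heavier′ (z ∷ zs) (refl , zs∈q) z≢x = heavier zs zs∈q (λ e → z≢x (cong (fz ∷_) e))

module Rigidity (s' k t : ℕ) (t≤k : t ≤ k) where
  open PointSums (suc s')

  -- A function vanishing on heavy points and summing to 0 over every t-subcube is zero:
  -- by induction on t - w(x), x is the only point of its isolating t-subcube where the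
  -- function can be nonzero.
  rigidity : (h : Point (suc s') k → ℤ) → (∀ (q : Pattern (suc s') k t) → ΣQ q h ≡ 0ℤ) →
    (∀ y → t < d1 y → h y ≡ 0ℤ) → ∀ x → h x ≡ 0ℤ
  rigidity h subcubeZero heavyZero x = below (suc t) x (NP.m≤n+m (suc t) (d1 x))
    where
    below : ∀ n x → t < d1 x +ℕ n → h x ≡ 0ℤ
    below zero x t<w = heavyZero x (subst (t <_) (NP.+-identityʳ (d1 x)) t<w)
    below (suc n) x t<w+n+1 with t <? d1 x
    ... | yes heavy = heavyZero x heavy
    ... | no light = fromIsolating (isolating x (t ∸ d1 x) room)
      where
      w≤t : d1 x ≤ t
      w≤t = NP.≮⇒≥ light
      room : d1 x +ℕ (t ∸ d1 x) ≤ k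
      room = subst (_≤ k) (sym (NP.m+[n∸m]≡n w≤t)) t≤k
      fromIsolating : Isolating x (t ∸ d1 x) → h x ≡ 0ℤ
      fromIsolating (r , r≡ , q , x∈q , heavier) with trans r≡ (NP.m+[n∸m]≡n w≤t)
      ... | refl = begin
        h x                              ≡⟨ sym (ΣP-δ k x h) ⟩
        ΣP k (λ z → 𝟙 (z ≟P x) * h z)    ≡⟨ ΣP-cong k onlyAtx ⟩
        ΣQ q h                           ≡⟨ subcubeZero q ⟩
        0ℤ                               ∎
        where
        onlyAtx : ∀ z → 𝟙 (z ≟P x) * h z ≡ 𝟙 (match? q z) * h z
        onlyAtx z with z ≟P x
        ... | yes refl = trans (ZP.*-identityˡ (h x)) (sym (𝟙-true x∈q (match? q x) (h x)))
        ... | no z≢x with match? q z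
        ...   | no _ = refl
        ...   | yes z∈q = trans (ZP.*-zeroˡ (h z)) (sym (trans (ZP.*-identityˡ (h z)) (below n z t<w+n)))
          where
          t<w+n : t < d1 z +ℕ n
          t<w+n = NP.<-≤-trans (subst (t <_) (NP.+-suc (d1 x) n) t<w+n+1)
                               (NP.+-monoˡ-≤ n (heavier z z∈q z≢x))

module Main (s' k t lam : ℕ) (t≤k : t ≤ k) where
  open PointSums (suc s')
  open Coarsening (suc s')
  open Multiplicity (suc s')
  open Rigidity s' k t t≤k

  oa⇒subcubes : ∀ {n} (A : Vec (Point (suc s') k) n) → IsOAStrength lam (suc s') k t A →
    ∀ (q : Pattern (suc s') k t) → ΣQ q (mult A) ≡ + lam
  oa⇒subcubes A isOA q = begin
    ΣQ q (mult A)               ≡⟨ sym (count-subcube q A) ⟩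
    + count (match? q) A        ≡⟨ cong +_ (count-⇔ (match? q) P? to from A) ⟩
    + count P? A                ≡⟨ cong +_ (isOA (columnsOf q) (columnsOf-injective q) u) ⟩
    + lam                       ∎
    where
    u : Vec (Fin (suc s')) t
    u = tabulate (levelsOf q)
    P? : ∀ x → Dec (tabulate (λ j → lookup x (columnsOf q j)) ≡ u)
    P? x = VP.≡-dec FP._≟_ (tabulate (λ j → lookup x (columnsOf q j))) u
    to : ∀ x → Match q x → tabulate (λ j → lookup x (columnsOf q j)) ≡ u
    to x x∈q = proj₂ (projection⇔ x (columnsOf q) u)
      (λ j → trans (proj₂ (describes-self q x) x∈q j) (sym (VP.lookup∘tabulate (levelsOf q) j)))
    from : ∀ x → tabulate (λ j → lookup x (columnsOf q j)) ≡ u → Match q x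
    from x e = proj₁ (describes-self q x)
      (λ j → trans (proj₁ (projection⇔ x (columnsOf q) u) e j) (VP.lookup∘tabulate (levelsOf q) j))

  subcubes⇒oa : ∀ {n} (A : Vec (Point (suc s') k) n) →
    (∀ (q : Pattern (suc s') k t) → ΣQ q (mult A) ≡ + lam) → IsOAStrength lam (suc s') k t A
  subcubes⇒oa A sums c inj u = ZP.+-injective (begin
    + count P? A                         ≡⟨ count-mult P? A ⟩
    ΣP k (λ x → 𝟙 (P? x) * mult A x)     ≡⟨ ΣP-cong k (λ x → cong (_* mult A x) sameIndicator) ⟩
    ΣQ q (mult A)                        ≡⟨ sums q ⟩
    + lam                                ∎)
    where
    P? : ∀ x → Dec (tabulate (λ j → lookup x (c j)) ≡ u)
    P? x = VP.≡-dec FP._≟_ (tabulate (λ j → lookup x (c j))) u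
    described : Σ (Pattern (suc s') k t) (Describes c (lookup u))
    described = patternFor k t c inj (lookup u)
    q : Pattern (suc s') k t
    q = proj₁ described
    sameIndicator : ∀ {x} → 𝟙 (P? x) ≡ 𝟙 (match? q x)
    sameIndicator {x} = 𝟙-⇔ (λ e → proj₁ (proj₂ described x) (proj₁ (projection⇔ x c u) e))
                            (λ x∈q → proj₂ (projection⇔ x c u) (proj₂ (proj₂ described x) x∈q))
                            (P? x) (match? q x)

  oaFromSolution : SystemHasIntegerSolution lam (suc s') k t → OAExists lam (suc s') k t
  oaFromSolution (N , lightOK , heavyOK) = array , subcubes⇒oa array arraySums
    where
    open Completion s' k t lam N
    m : Point (suc s') k → ℕ
    m x = ℤ.∣ completion x ∣
    m≡ : ∀ x → + m x ≡ completion x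
    m≡ x = ZP.0≤i⇒+∣i∣≡i (completion-nonneg lightOK heavyOK x)
    rows : Vec (Point (suc s') k) (sumℕ m (allPoints (suc s') k))
    rows = rowsOf m (allPoints (suc s') k)
    rowCount : sumℕ m (allPoints (suc s') k) ≡ lam *ℕ suc s' ^ℕ t
    rowCount = ZP.+-injective (trans (sumℕ-ΣL m (allPoints (suc s') k))
                 (trans (ΣP-cong k m≡) (totalSum completion t≤k subcubeSum-completion)))
    array : Vec (Point (suc s') k) (lam *ℕ suc s' ^ℕ t)
    array = subst (Vec (Point (suc s') k)) rowCount rows
    mult-array : ∀ x → mult array x ≡ completion x
    mult-array x = trans (cong +_ (count-subst (_≟P x) rowCount rows)) (trans (mult-rowsOf m x) (m≡ x))
    arraySums : ∀ (q : Pattern (suc s') k t) → ΣQ q (mult array) ≡ + lam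
    arraySums q = trans (ΣQ-cong q mult-array) (subcubeSum-completion q)

  -- The multiplicities of an OA are the completion of their own heavy values: their
  -- difference vanishes on heavy points and sums to 0 over every t-subcube.
  mult-isCompletion : ∀ {n} (A : Vec (Point (suc s') k) n) → IsOAStrength lam (suc s') k t A →
    ∀ x → mult A x ≡ Completion.completion s' k t lam (mult A) x
  mult-isCompletion A isOA x = begin
    mult A x                       ≡⟨ rearrange (mult A x) (completion x) ⟩
    completion x + difference x    ≡⟨ cong (_+_ (completion x)) (rigidity difference differenceSums heavyZero x) ⟩
    completion x + 0ℤ              ≡⟨ ZP.+-identityʳ (completion x) ⟩
    completion x                   ∎
    where
    open Completion s' k t lam (mult A)
    difference : Point (suc s') k → ℤ
    difference x = mult A x - completion x
    heavyZero : ∀ y → t < d1 y → difference y ≡ 0ℤ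
    heavyZero y heavy = trans (cong (λ z → mult A y - z) (completion-heavy y heavy)) (ZP.+-inverseʳ (mult A y))
    differenceSums : ∀ (q : Pattern (suc s') k t) → ΣQ q difference ≡ 0ℤ
    differenceSums q = begin
      ΣQ q difference
        ≡⟨ ΣP-cong k (λ x → distribute (𝟙 (match? q x)) (mult A x) (completion x)) ⟩
      ΣP k (λ x → 𝟙 (match? q x) * mult A x + -1ℤ * (𝟙 (match? q x) * completion x))
        ≡⟨ ΣP-+ k (λ x → 𝟙 (match? q x) * mult A x) (λ x → -1ℤ * (𝟙 (match? q x) * completion x)) ⟩
      ΣQ q (mult A) + ΣP k (λ x → -1ℤ * (𝟙 (match? q x) * completion x))
        ≡⟨ cong (_+_ (ΣQ q (mult A))) (ΣP-* k -1ℤ (λ x → 𝟙 (match? q x) * completion x)) ⟩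
      ΣQ q (mult A) + -1ℤ * ΣQ q completion
        ≡⟨ cong₂ (λ u v → u + -1ℤ * v) (oa⇒subcubes A isOA q) (subcubeSum-completion q) ⟩
      + lam + -1ℤ * + lam
        ≡⟨ cancel (+ lam) ⟩
      0ℤ ∎
      where
      distribute : ∀ i a b → i * (a - b) ≡ i * a + -1ℤ * (i * b)
      distribute = solve-∀
      cancel : ∀ l → l + -1ℤ * l ≡ 0ℤ
      cancel = solve-∀
    rearrange : ∀ a b → a ≡ b + (a - b)
    rearrange = solve-∀

  -- An OA gives a solution: N are its multiplicities, and the constraint of a light x is
  -- the multiplicity of x.
  solutionFromOA : OAExists lam (suc s') k t → SystemHasIntegerSolution lam (suc s') k t
  solutionFromOA (A , isOA) = mult A , lightOK , (λ _ _ → ℤ.+≤+ z≤n)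
    where
    open Completion s' k t lam (mult A)
    lightOK : ∀ x → d1 x ≤ t → 0ℤ ℤ.≤ constraint x
    lightOK x light =
      subst (0ℤ ℤ.≤_) (trans (mult-isCompletion A isOA x) (completion-light x light)) (ℤ.+≤+ z≤n)

-- The theorem.  Of the hypotheses only s ≥ 1 (so that the level 1 exists) and t ≤ k are used;
-- the case s = 0 is ruled out by 2 ≤ s.
theorem2 : (s k t lam : ℕ) → 2 ≤ s → 1 ≤ k → t ≤ k → 1 ≤ lam →
    OAExists lam s k t ⇔ SystemHasIntegerSolution lam s k t
theorem2 (suc s') k t lam _ _ t≤k _ = mk⇔ solutionFromOA oaFromSolution
  where open Main s' k t lam t≤k
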